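{- Let $G$ be a finite simple undirected graph, $k\ge1$ an integer, and let $\beta_k$ be the largest real root of $x^{k+2}-2x^{k+1}+1=0$. Consider any execution of the algorithm $\mathsf{kDC\text{ - }two}(G,k)$ described in the context and any search tree $\mathcal{T}$ generated by one of its top-level calls of $\mathsf{BB}$. For every node $I$ of $\mathcal{T}$, $\ell_{\mathcal{T}}(I)<2\cdot\beta_k^{|I|}$.
   Context: All graphs are finite, simple and undirected. For a graph $g$ and $X\subseteq V(g)$, a non-edge of $X$ is an unordered pair of distinct non-adjacent vertices of $X$; $\overline{E}_g(X)$ is the set of non-edges of $X$. For an integer $k\ge1$, $X$ is a $k$-defective clique of $g$ if $|\overline{E}_g(X)|\le k$. $d_g(u)$ is the degree of $u$ in $g$. A degeneracy ordering of $G$ ($n=|V(G)|$) is an ordering $(v_1,\dots,v_n)$ of $V(G)$ such that each $v_i$ has minimum degree in $G[\{v_i,\dots,v_n\}]$. For $A\subseteq V(G)$, $N[A]$ denotes $A$ together with all neighbors of vertices of $A$. Algorithm $\mathsf{kDC\text{ - }two}(G,k)$: set $C^*:=\emptyset$; compute a degeneracy ordering $(v_1,\dots,v_n)$; for each $i$: let $A:=N_G(v_i)\cap\{v_i,\dots,v_n\}$, let $g_{v_i}$ be the subgraph of $G$ induced by $N[A]\cap\{v_i,\dots,v_n\}$, and call $\mathsf{BB}(g_{v_i},\{v_i\})$. Afterwards, if $|C^*|<k+1$, call $\mathsf{BB}(G,\emptyset)$. Return $C^*$. Procedure $\mathsf{BB}(g,S)$ ($S\subseteq V(g)$): apply the following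 rules in arbitrary order until neither applies, obtaining $(g',S')$: (RR1) if some $u\in V(g)\setminus S$ has $|\overline{E}_g(S\cup\{u\})|>k$, delete $u$ from $g$; (RR2) if some $u\in V(g)\setminus S$ has $|\overline{E}_g(S\cup\{u\})|\le k$ and $d_g(u)\ge|V(g)|-2$, add $u$ to $S$. If $V(g')$ is a $k$-defective clique, set $C^*:=V(g')$ if $|V(g')|>|C^*|$ and return. Otherwise choose $b\in V(g')\setminus S'$ by rule (BR): a vertex of $V(g')\setminus S'$ with at least one non-neighbor in $S'$ if one exists, otherwise an arbitrary vertex of $V(g')\setminus S'$; then call $\mathsf{BB}(g',S'\cup\{b\})$ and $\mathsf{BB}(g'-b,S')$. Search tree: each top-level call of $\mathsf{BB}$ generates a recursion tree $\mathcal{T}$ whose nodes are the invocations of $\mathsf{BB}$; a non-leaf invocation has as left child the invocation $\mathsf{BB}(g',S'\cup\{b\})$ and as right child $\mathsf{BB}(g'-b,S')$; leaves are the invocations that return because $V(g')$ is a $k$-defective clique. For a node $I$ corresponding to $\mathsf{BB}(g,S)$, $I.g:=g'$ and $I.S:=S'$ (after applying RR1 and RR2), except that if $V(g')$ is a $k$-defective clique then $I.S:=V(g')$. The size of $I$ is $|I|:=|V(I.g)\setminus I.S|$, and $\ell_{\mathcal{T}}(I)$ is the number of leaves of $\mathcal{T}$ in the subtree rooted at $I$. -}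

module Defs where

open import Data.Bool using (Bool; true; false; _∧_; not; if_then_else_)
open import Data.Nat as ℕ using (ℕ; zero; suc; _≤_; _<_; _∸_; _<ᵇ_)
open import Data.Fin using (Fin; toℕ)
open import Data.Fin.Subset using (Subset; _∈_; _∉_; _∪_; _─_; _-_; ⁅_⁆; ∣_∣)
open import Data.List using (List; map)
open import Data.Nat.ListAction using (sum)
open import Data.Bool.ListAction using (any)
open import Data.Integer using (+_)
open import Data.List.Base using (allFin)
open import Data.Product using (Σ; ∃; _×_)
open import Data.Sum using (_⊎_)
open import Data.Vec using (lookup)
open import Function.Definitions using (Injective)
open import Relation.Binary.PropositionalEquality using (_≡_)
open import Relation.Binary.Construct.Closure.ReflexiveTransitive using (Star)
open import Relation.Nullary using (¬_)
open import Data.Rational as ℚ using (ℚ; 0ℚ; 1ℚ)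

record Graph (n : ℕ) : Set where
  field
    adj    : Fin n → Fin n → Bool
    sym    : ∀ u v → adj u v ≡ adj v u
    irrefl : ∀ u → adj u u ≡ false
open Graph public

module _ {n : ℕ} where

  countᵇ : (Fin n → Bool) → ℕ
  countᵇ f = sum (map (λ x → if f x then 1 else 0) (allFin n))

  memᵇ : Subset n → Fin n → Bool
  memᵇ X u = lookup X u

  nonEdges : Graph n → Subset n → ℕ
  nonEdges G X = sum (map (λ u → countᵇ (λ v →
     memᵇ X u ∧ memᵇ X v ∧ (toℕ u <ᵇ toℕ v) ∧ not (adj G u v))) (allFin n))

  deg : Graph n → Subset n → Fin n → ℕ
  deg G X u = countᵇ (λ v → memᵇ X v ∧ adj G u v)

  IsKDC : ℕ → Graph n → Subset n → Set
  IsKDC k G X = nonEdges G X ≤ k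

  -- States of BB: (V, S), the graph g being the induced subgraph G[V]
  -- (every graph occurring in kDC-two is an induced subgraph of G).

  State : Set
  State = Subset n × Subset n

  data Step (k : ℕ) (G : Graph n) : State → State → Set where
    rr1 : ∀ {V S} u → u ∈ V → u ∉ S →
          k < nonEdges G (S ∪ ⁅ u ⁆) →
          Step k G (V Data.Product., S) ((V - u) Data.Product., S)
    rr2 : ∀ {V S} u → u ∈ V → u ∉ S →
          nonEdges G (S ∪ ⁅ u ⁆) ≤ k →
          ∣ V ∣ ∸ 2 ≤ deg G V u →
          Step k G (V Data.Product., S) (V Data.Product., (S ∪ ⁅ u ⁆))

  Irreducible : ℕ → Graph n → State → Set
  Irreducible k G st = ∀ st' → ¬ Step k G st st'

  Reduce : ℕ → Graph n → State → State → Set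
  Reduce k G st st' = Star (Step k G) st st' × Irreducible k G st'

  HasNonNbr : Graph n → Subset n → Fin n → Set
  HasNonNbr G S u = ∃ λ s → s ∈ S × adj G u s ≡ false

  BR : Graph n → Subset n → Subset n → Fin n → Set
  BR G V S b = HasNonNbr G S b
             ⊎ (∀ u → u ∈ V → u ∉ S → ¬ HasNonNbr G S u)

-- Search trees: each node stores (I.g, I.S) as vertex subsets.
data Tree (n : ℕ) : Set where
  leaf : Subset n → Subset n → Tree n
  node : Subset n → Subset n → Tree n → Tree n → Tree n

module _ {n : ℕ} where
  open Data.Product using (_,_)

  -- Run k G V S t : t is a possible recursion tree of BB(G[V], S)
  data Run (k : ℕ) (G : Graph n) : Subset n → Subset n → Tree n → Set where
    leafR : ∀ {V S V' S'} →
            Reduce k G (V , S) (V' , S') →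
            IsKDC k G V' →
            Run k G V S (leaf V' V')
    nodeR : ∀ {V S V' S' l r} b →
            Reduce k G (V , S) (V' , S') →
            ¬ IsKDC k G V' →
            b ∈ V' → b ∉ S' → BR G V' S' b →
            Run k G V' (S' ∪ ⁅ b ⁆) l →
            Run k G (V' - b) S' r →
            Run k G V S (node V' S' l r)

  leaves : Tree n → ℕ
  leaves (leaf _ _)     = 1
  leaves (node _ _ l r) = leaves l ℕ.+ leaves r

  size : Tree n → ℕ
  size (leaf V S)     = ∣ V ─ S ∣
  size (node V S _ _) = ∣ V ─ S ∣

  data _≼_ : Tree n → Tree n → Set where
    here : ∀ {t} → t ≼ t
    inL  : ∀ {t V S l r} → t ≼ l → t ≼ node V S l r
    inR  : ∀ {t V S l r} → t ≼ r → t ≼ node V S l r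

  data AllLeavesSmall (k : ℕ) : Tree n → Set where
    leafS : ∀ {V S} → ∣ V ∣ ≤ k → AllLeavesSmall k (leaf V S)
    nodeS : ∀ {V S l r} → AllLeavesSmall k l → AllLeavesSmall k r →
            AllLeavesSmall k (node V S l r)

  Later : (Fin n → Fin n) → Fin n → Subset n
  Later pos v = Data.Vec.tabulate (λ u → toℕ (pos v) ℕ.≤ᵇ toℕ (pos u))

  -- pos encodes a degeneracy ordering (v at position pos v)
  IsDegeneracyOrdering : Graph n → (Fin n → Fin n) → Set
  IsDegeneracyOrdering G pos =
    Injective _≡_ _≡_ pos ×
    (∀ v u → u ∈ Later pos v → deg G (Later pos v) v ≤ deg G (Later pos v) u)

  Nbr : Graph n → Fin n → Subset n
  Nbr G v = Data.Vec.tabulate (adj G v)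

  ClosedNbr : Graph n → Subset n → Subset n
  ClosedNbr G A = Data.Vec.tabulate (λ u →
    memᵇ A u Data.Bool.∨ any (λ a → memᵇ A a ∧ adj G a u) (allFin n))

  -- vertex set of g_v  (v added explicitly)
  Gv : Graph n → (Fin n → Fin n) → Fin n → Subset n
  Gv G pos v = (ClosedNbr G (Nbr G v ∩' Later pos v) ∩' Later pos v) ∪ ⁅ v ⁆
    where open Data.Fin.Subset renaming (_∩_ to _∩'_)

  full : Subset n
  full = Data.Fin.Subset.⊤

  empty : Subset n
  empty = Data.Fin.Subset.⊥

  TopLevelTree : ℕ → Graph n → Tree n → Set
  TopLevelTree k G T =
      (Σ (Fin n → Fin n) λ pos → IsDegeneracyOrdering G pos ×
         ∃ λ v → Run k G (Gv G pos v) ⁅ v ⁆ T)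
    ⊎ (Σ (Fin n → Fin n) λ pos → IsDegeneracyOrdering G pos ×
         Σ (Fin n → Tree n) λ Ts →
           (∀ v → Run k G (Gv G pos v) ⁅ v ⁆ (Ts v)) ×
           (∀ v → AllLeavesSmall k (Ts v)) ×      -- |C*| < k+1 after loop
           Run k G full empty T)

_^ℚ_ : ℚ → ℕ → ℚ
x ^ℚ zero  = 1ℚ
x ^ℚ suc m = x ℚ.* (x ^ℚ m)

pk : ℕ → ℚ → ℚ
pk k x = (x ^ℚ (k ℕ.+ 2)) ℚ.- ((+ 2 ℚ./ 1) ℚ.* (x ^ℚ (k ℕ.+ 1))) ℚ.+ 1ℚ

-- For x ≥ 1: p_k(x) < 0 iff 1 < x < β_k, so β_k = sup{x ≥ 1 | p_k x < 0};
-- by continuity L < 2 β_k^s iff some rational x ≥ 1 with p_k x < 0 has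
-- L < 2 x^s.
LtTwoBetaPow : ℕ → ℕ → ℕ → Set
LtTwoBetaPow k L s =
  ∃ λ (x : ℚ) → 1ℚ ℚ.≤ x × pk k x ℚ.< 0ℚ ×
                (+ L ℚ./ 1) ℚ.< (+ 2 ℚ./ 1) ℚ.* (x ^ℚ s)

module Submission where

-- A state (V, S) of BB is measured by its number s of undecided vertices, its remaining
-- non-edge budget t = k - |Ē(S)| and the number p ≤ 2 of known pending vertices (undecided
-- vertices with a non-neighbour in S). Branching on a pending vertex spends budget in the left
-- child. Branching on a vertex b while nothing is pending happens only when RR2 failed for b,
-- so b has two non-neighbours, and these are pending in the left child. Hence the number of
-- leaves below a state is at most Ψ s t p / W s for any Ψ satisfying the corresponding
-- recurrences (a Potential). Since LtTwoBetaPow asks for a rational x with p_k(x) < 0, i.e.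
-- x < β_k, the growth rate of Ψ has to lie strictly below β_k: for each k we give a Potential
-- of growth rate a / b with p_k(a / b) < 0 and ℓ < 2 (a / b)^s. For k ≥ 2 it is geometric;
-- for k = 1 it is tabulated for s < 29, where the geometric bound is too coarse.

module RationalWitness where

  open import Data.Integer as ℤ using (+_)
  import Data.Integer.Properties as ℤ
  open import Data.Nat as ℕ using (ℕ; zero; suc)
  import Data.Nat.Properties as ℕ
  open import Data.Nat.Coprimality using (Coprime; 1-coprimeTo)
  import Data.Nat.Coprimality as Coprime
  open import Data.Product using (_,_)
  open import Data.Rational as ℚ using (ℚ; mkℚ; 0ℚ; 1ℚ; _/_; _*_; _+_; _-_; _<_; _≤_; 1/_)
  import Data.Rational.Properties as ℚ
  open import Data.Rational.Solver using (module +-*-Solver)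
  open import Relation.Binary.PropositionalEquality

  open import Defs using (_^ℚ_; pk; LtTwoBetaPow)

  ι : ℕ → ℚ
  ι n = + n / 1

  private
    ι≡mkℚ : ∀ n → ι n ≡ mkℚ (+ n) 0 (Coprime.sym (1-coprimeTo n))
    ι≡mkℚ n = ℚ.normalize-coprime (Coprime.sym (1-coprimeTo n))

  ι-+ : ∀ m n → ι m + ι n ≡ ι (m ℕ.+ n)
  ι-+ m n rewrite ι≡mkℚ m | ι≡mkℚ n = cong (_/ 1)
    (trans (cong₂ ℤ._+_ (ℤ.*-identityʳ (+ m)) (ℤ.*-identityʳ (+ n))) (sym (ℤ.pos-+ m n)))

  ι-* : ∀ m n → ι m * ι n ≡ ι (m ℕ.* n)
  ι-* m n rewrite ι≡mkℚ m | ι≡mkℚ n = cong (_/ 1) (sym (ℤ.pos-* m n))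

  ι-^ : ∀ m s → ι m ^ℚ s ≡ ι (m ℕ.^ s)
  ι-^ m zero    = refl
  ι-^ m (suc s) = trans (cong (ι m *_) (ι-^ m s)) (ι-* m (m ℕ.^ s))

  ι-mono-< : ∀ {m n} → m ℕ.< n → ι m < ι n
  ι-mono-< {m} {n} m<n rewrite ι≡mkℚ m | ι≡mkℚ n =
    ℚ.*<* (subst₂ ℤ._<_ (sym (ℤ.*-identityʳ (+ m))) (sym (ℤ.*-identityʳ (+ n))) (ℤ.+<+ m<n))

  ι-mono-≤ : ∀ {m n} → m ℕ.≤ n → ι m ≤ ι n
  ι-mono-≤ {m} {n} m≤n rewrite ι≡mkℚ m | ι≡mkℚ n =
    ℚ.*≤* (subst₂ ℤ._≤_ (sym (ℤ.*-identityʳ (+ m))) (sym (ℤ.*-identityʳ (+ n))) (ℤ.+≤+ m≤n))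

  ι-nonNeg : ∀ n → ℚ.NonNegative (ι n)
  ι-nonNeg n = ℚ.normalize-nonNeg n 1

  ι-pos : ∀ n .{{_ : ℕ.NonZero n}} → ℚ.Positive (ι n)
  ι-pos n = ℚ.normalize-pos n 1

  ^ℚ-distribʳ-* : ∀ p q s → (p * q) ^ℚ s ≡ p ^ℚ s * q ^ℚ s
  ^ℚ-distribʳ-* p q zero    = sym (ℚ.*-identityˡ 1ℚ)
  ^ℚ-distribʳ-* p q (suc s) =
    trans (cong ((p * q) *_) (^ℚ-distribʳ-* p q s)) (interchange p q (p ^ℚ s) (q ^ℚ s))
    where
    open +-*-Solver
    interchange : ∀ p q x y → (p * q) * (x * y) ≡ (p * x) * (q * y)
    interchange = solve 4 (λ p q x y → (p :* q) :* (x :* y) := (p :* x) :* (q :* y)) refl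

  module Ratio (a b : ℕ) .{{b≢0 : ℕ.NonZero b}} where

    instance
      ι-b≢0 : ℚ.NonZero (ι b)
      ι-b≢0 = ℚ.pos⇒nonZero (ι b) {{ι-pos b}}

    x : ℚ
    x = ι a * 1/ ι b

    x*b≡a : x * ι b ≡ ι a
    x*b≡a = begin
      (ι a * 1/ ι b) * ι b   ≡⟨ ℚ.*-assoc (ι a) (1/ ι b) (ι b) ⟩
      ι a * (1/ ι b * ι b)   ≡⟨ cong (ι a *_) (ℚ.*-inverseˡ (ι b)) ⟩
      ι a * 1ℚ               ≡⟨ ℚ.*-identityʳ (ι a) ⟩
      ι a                    ∎
      where open ≡-Reasoning

    x^s*b^s≡a^s : ∀ s → x ^ℚ s * ι b ^ℚ s ≡ ι (a ℕ.^ s)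
    x^s*b^s≡a^s s = trans (sym (^ℚ-distribʳ-* x (ι b) s)) (trans (cong (_^ℚ s) x*b≡a) (ι-^ a s))

    1≤x : b ℕ.≤ a → 1ℚ ≤ x
    1≤x b≤a = ℚ.*-cancelˡ-≤-pos (ι b) {{ι-pos b}}
      (subst₂ _≤_ (sym (ℚ.*-identityʳ (ι b))) (trans (sym x*b≡a) (ℚ.*-comm x (ι b))) (ι-mono-≤ b≤a))

    below-2x^s : ∀ L s → L ℕ.* b ℕ.^ s ℕ.< 2 ℕ.* a ℕ.^ s → ι L < ι 2 * x ^ℚ s
    below-2x^s L s L*b^s<2*a^s = ℚ.*-cancelʳ-<-nonNeg (ι b ^ℚ s) {{b^s≥0}}
      (subst₂ _<_ (sym lhs) (sym rhs) (ι-mono-< L*b^s<2*a^s))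
      where
      b^s≥0 : ℚ.NonNegative (ι b ^ℚ s)
      b^s≥0 = subst ℚ.NonNegative (sym (ι-^ b s)) (ι-nonNeg (b ℕ.^ s))
      lhs : ι L * ι b ^ℚ s ≡ ι (L ℕ.* b ℕ.^ s)
      lhs = trans (cong (ι L *_) (ι-^ b s)) (ι-* L (b ℕ.^ s))
      rhs : (ι 2 * x ^ℚ s) * ι b ^ℚ s ≡ ι (2 ℕ.* a ℕ.^ s)
      rhs = trans (ℚ.*-assoc (ι 2) (x ^ℚ s) (ι b ^ℚ s))
                  (trans (cong (ι 2 *_) (x^s*b^s≡a^s s)) (ι-* 2 (a ℕ.^ s)))

    pk-scaled : ∀ k → pk k x * (ι b * ι b ^ℚ (k ℕ.+ 1)) ≡
                ι (a ℕ.* a ℕ.^ (k ℕ.+ 1)) - ι (2 ℕ.* a ℕ.^ (k ℕ.+ 1) ℕ.* b) + ι (b ℕ.* b ℕ.^ (k ℕ.+ 1))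
    pk-scaled k = begin
      (x ^ℚ (k ℕ.+ 2) - ι 2 * P + 1ℚ) * (ι b * B)
        ≡⟨ cong (λ e → (x ^ℚ e - ι 2 * P + 1ℚ) * (ι b * B)) (ℕ.+-suc k 1) ⟩
      (x * P - ι 2 * P + 1ℚ) * (ι b * B)
        ≡⟨ expand x P (ι 2) (ι b) B ⟩
      (x * ι b) * (P * B) - ι 2 * (P * B) * ι b + ι b * B
        ≡⟨ cong₂ (λ xb PB → xb * PB - ι 2 * PB * ι b + ι b * B) x*b≡a (x^s*b^s≡a^s (k ℕ.+ 1)) ⟩
      ι a * ι A - ι 2 * ι A * ι b + ι b * B
        ≡⟨ cong₃ (λ u v w → u - v + w) (ι-* a A) (trans (cong (_* ι b) (ι-* 2 A)) (ι-* (2 ℕ.* A) b))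
                 (trans (cong (ι b *_) (ι-^ b (k ℕ.+ 1))) (ι-* b (b ℕ.^ (k ℕ.+ 1)))) ⟩
      ι (a ℕ.* A) - ι (2 ℕ.* A ℕ.* b) + ι (b ℕ.* b ℕ.^ (k ℕ.+ 1))
        ∎
      where
      open ≡-Reasoning
      open +-*-Solver
      P = x ^ℚ (k ℕ.+ 1)
      B = ι b ^ℚ (k ℕ.+ 1)
      A = a ℕ.^ (k ℕ.+ 1)
      cong₃ : ∀ (f : ℚ → ℚ → ℚ → ℚ) {u u′ v v′ w w′} →
              u ≡ u′ → v ≡ v′ → w ≡ w′ → f u v w ≡ f u′ v′ w′
      cong₃ f refl refl refl = refl
      expand : ∀ (x p t b c : ℚ) →
               (x * p - t * p + 1ℚ) * (b * c) ≡ (x * b) * (p * c) - t * (p * c) * b + b * c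
      expand = solve 5 (λ x p t b c → (x :* p :- t :* p :+ con 1ℚ) :* (b :* c)
                                      := (x :* b) :* (p :* c) :- t :* (p :* c) :* b :+ b :* c) refl

    pk-x<0 : ∀ k → a ℕ.^ (k ℕ.+ 2) ℕ.+ b ℕ.^ (k ℕ.+ 2) ℕ.< 2 ℕ.* a ℕ.^ (k ℕ.+ 1) ℕ.* b → pk k x < 0ℚ
    pk-x<0 k pk<0 = ℚ.*-cancelʳ-<-nonNeg (ι b * ι b ^ℚ (k ℕ.+ 1)) {{b^[k+2]≥0}}
      (subst₂ _<_ (sym (pk-scaled k)) (sym (ℚ.*-zeroˡ (ι b * ι b ^ℚ (k ℕ.+ 1))))
        (u-v+w<0 a^[k+2] _ b^[k+2] pk<0′))
      where
      a^[k+2] = a ℕ.* a ℕ.^ (k ℕ.+ 1)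
      b^[k+2] = b ℕ.* b ℕ.^ (k ℕ.+ 1)
      pk<0′ : a^[k+2] ℕ.+ b^[k+2] ℕ.< 2 ℕ.* a ℕ.^ (k ℕ.+ 1) ℕ.* b
      pk<0′ = subst₂ (λ u w → u ℕ.+ w ℕ.< 2 ℕ.* a ℕ.^ (k ℕ.+ 1) ℕ.* b)
                (cong (a ℕ.^_) (ℕ.+-suc k 1)) (cong (b ℕ.^_) (ℕ.+-suc k 1)) pk<0
      b^[k+2]≥0 : ℚ.NonNegative (ι b * ι b ^ℚ (k ℕ.+ 1))
      b^[k+2]≥0 = subst ℚ.NonNegative (sym (ι-^ b (suc (k ℕ.+ 1)))) (ι-nonNeg b^[k+2])
      u-v+w<0 : ∀ u v w → u ℕ.+ w ℕ.< v → ι u - ι v + ι w < 0ℚ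
      u-v+w<0 u v w u+w<v = subst₂ _<_ (rearrange (ι u) (ι v) (ι w)) (ℚ.+-inverseʳ (ι v))
        (ℚ.+-monoˡ-< (ℚ.- ι v) (subst (_< ι v) (sym (ι-+ u w)) (ι-mono-< u+w<v)))
        where
        open +-*-Solver
        rearrange : ∀ u v w → (u + w) - v ≡ u - v + w
        rearrange = solve 3 (λ u v w → (u :+ w) :- v := u :- v :+ w) refl

    ltTwoBetaPow : ∀ k L s → b ℕ.≤ a →
                   a ℕ.^ (k ℕ.+ 2) ℕ.+ b ℕ.^ (k ℕ.+ 2) ℕ.< 2 ℕ.* a ℕ.^ (k ℕ.+ 1) ℕ.* b →
                   L ℕ.* b ℕ.^ s ℕ.< 2 ℕ.* a ℕ.^ s → LtTwoBetaPow k L s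
    ltTwoBetaPow k L s b≤a pk<0 L*b^s<2*a^s =
      x , 1≤x b≤a , pk-x<0 k pk<0 , below-2x^s L s L*b^s<2*a^s

open import Data.Bool using (Bool; true; false; _∧_; not; if_then_else_; T)
open import Data.Bool.Properties using (T-≡; T-not-≡; T-∧)
open import Data.Empty using (⊥-elim)
open import Data.Fin using (Fin; zero; suc; toℕ)
open import Data.Fin.Properties using (toℕ-injective) renaming (_≟_ to _≟ᶠ_)
open import Data.Fin.Subset
  using (Subset; inside; outside; _∈_; _∉_; _⊆_; _∩_; _∪_; _─_; _-_; ⁅_⁆; ∣_∣; Nonempty)
open import Data.Fin.Subset.Properties
  using (_∈?_; nonempty?; Empty-unique; ∣⊥∣≡0; p─⊥≡p; p─q─r≡p─q∪r; p─q─r≡p─r─q;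
         x∈p∧x∉q⇒x∈p─q; x∈p∧x≢y⇒x∈p-y; x∈p∪q⁺; x∈⁅x⁆;
         p⊆p∪q; p─q⊆p; p⊂q⇒∣p∣<∣q∣; p⊆q⇒∣p∣≤∣q∣; drop-there)
open import Data.List using (List; []; _∷_; map; allFin)
import Data.List.Membership.Propositional as List
open import Data.List.Membership.Propositional.Properties using (∈-allFin)
open import Data.List.Properties using (map-cong; map-tabulate)
open import Data.List.Relation.Unary.Any using (here; there)
open import Data.Nat
  using (ℕ; zero; suc; _+_; _*_; _∸_; _^_; _≤_; _<_; _≤?_; _<?_; _<ᵇ_; z≤n; s≤s; s≤s⁻¹; NonZero; >-nonZero)
open import Data.Nat.ListAction using (sum)
open import Data.Nat.Properties
open import Algebra.Properties.CommutativeSemigroup *-commutativeSemigroup using (x∙yz≈y∙xz)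
open import Data.Nat.Tactic.RingSolver using (solve-∀)
open import Data.Product using (∃; ∃₂; _×_; _,_; proj₁; proj₂; uncurry)
open import Data.Sum using (inj₁; inj₂)
open import Data.Vec using ([]; _∷_; lookup; here; there)
open import Data.Vec.Properties using ([]=⇒lookup; lookup⇒[]=; lookup-zipWith; lookup∘tabulate)
open import Function using (_∘_; id; case_of_)
open import Function.Bundles using (Equivalence)
open import Relation.Binary.Construct.Closure.ReflexiveTransitive using (Star; ε; _◅_)
open import Relation.Binary.Definitions using (tri<; tri≈; tri>)
open import Relation.Binary.PropositionalEquality
open import Relation.Nullary using (¬_)
open import Relation.Nullary.Decidable using (Dec; yes; no; True; toWitness; from-yes; _→-dec_)

open import Defs hiding (sym)

open RationalWitness using (module Ratio)

private
  variable
    n : ℕ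

module _ {a} {A : Set a} {f g : A → ℕ} (f≤g : ∀ x → f x ≤ g x) where

  sum-map-mono : ∀ xs → sum (map f xs) ≤ sum (map g xs)
  sum-map-mono []       = z≤n
  sum-map-mono (x ∷ xs) = +-mono-≤ (f≤g x) (sum-map-mono xs)

  sum-map-mono-< : ∀ {xs y} → y List.∈ xs → f y < g y → sum (map f xs) < sum (map g xs)
  sum-map-mono-< {x ∷ xs} (here refl) fy<gy = +-mono-<-≤ fy<gy (sum-map-mono xs)
  sum-map-mono-< {x ∷ xs} (there y∈xs) fy<gy = +-mono-≤-< (f≤g x) (sum-map-mono-< y∈xs fy<gy)

sum-map-allFin-suc : ∀ (f : Fin (suc n) → ℕ) →
                     sum (map f (allFin (suc n))) ≡ f zero + sum (map (f ∘ suc) (allFin n))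
sum-map-allFin-suc {n} f = cong (λ xs → f zero + sum xs)
  (trans (map-tabulate suc f) (sym (map-tabulate id (f ∘ suc))))

indicator : Bool → ℕ
indicator b = if b then 1 else 0

module _ {f g : Fin n → Bool} where

  countᵇ-cong : (∀ x → f x ≡ g x) → countᵇ f ≡ countᵇ g
  countᵇ-cong f≗g = cong sum (map-cong (cong indicator ∘ f≗g) (allFin n))

  private
    indicator-mono : ∀ {a b} → (T a → T b) → indicator a ≤ indicator b
    indicator-mono {false}         _ = z≤n
    indicator-mono {true}  {true}  _ = ≤-refl
    indicator-mono {true}  {false} h = ⊥-elim (h _)

  module _ (f⇒g : ∀ x → T (f x) → T (g x)) where

    countᵇ-mono : countᵇ f ≤ countᵇ g
    countᵇ-mono = sum-map-mono (λ x → indicator-mono (f⇒g x)) (allFin n)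

    countᵇ-mono-< : ∀ {y} → ¬ T (f y) → T (g y) → countᵇ f < countᵇ g
    countᵇ-mono-< {y} ¬fy gy = sum-map-mono-< (λ x → indicator-mono (f⇒g x)) (∈-allFin y) (lt ¬fy gy)
      where
      lt : ∀ {a b} → ¬ T a → T b → indicator a < indicator b
      lt {false} {true} _ _ = s≤s z≤n
      lt {true}         ¬a _ = ⊥-elim (¬a _)

countᵇ-lookup : ∀ (p : Subset n) → countᵇ (lookup p) ≡ ∣ p ∣
countᵇ-lookup []            = refl
countᵇ-lookup (inside ∷ p)  = trans (sum-map-allFin-suc (indicator ∘ lookup (inside ∷ p)))
                                    (cong suc (countᵇ-lookup p))
countᵇ-lookup (outside ∷ p) = trans (sum-map-allFin-suc (indicator ∘ lookup (outside ∷ p)))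
                                    (countᵇ-lookup p)

module _ {x : Fin n} {p : Subset n} where

  ∈⇒T : x ∈ p → T (lookup p x)
  ∈⇒T = Equivalence.from T-≡ ∘ []=⇒lookup

  T⇒∈ : T (lookup p x) → x ∈ p
  T⇒∈ = lookup⇒[]= x p ∘ Equivalence.to T-≡

x∈p─q⁻ : ∀ {x : Fin n} (p q : Subset n) → x ∈ p ─ q → x ∈ p × x ∉ q
x∈p─q⁻             (inside ∷ p)  (outside ∷ q) here          = here , λ ()
x∈p─q⁻ {x = zero}  (outside ∷ p) (inside ∷ q)  ()
x∈p─q⁻ {x = zero}  (outside ∷ p) (outside ∷ q) ()
x∈p─q⁻             (_ ∷ p)       (_ ∷ q)       (there x∈p─q)
  with x∈p , x∉q ← x∈p─q⁻ p q x∈p─q = there x∈p , x∉q ∘ drop-there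

x∉p─p : ∀ {x : Fin n} (p : Subset n) → x ∉ p ─ p
x∉p─p p x∈p─p = let x∈p , x∉p = x∈p─q⁻ p p x∈p─p in x∉p x∈p

─-mono : ∀ {p₁ p₂ q₁ q₂ : Subset n} → p₁ ⊆ p₂ → q₂ ⊆ q₁ → p₁ ─ q₁ ⊆ p₂ ─ q₂
─-mono {p₁ = p₁} {q₁ = q₁} p₁⊆p₂ q₂⊆q₁ x∈ with x∈p─q⁻ p₁ q₁ x∈
... | x∈p₁ , x∉q₁ = x∈p∧x∉q⇒x∈p─q (p₁⊆p₂ x∈p₁) (x∉q₁ ∘ q₂⊆q₁)

∣p∣≡1+∣p-x∣ : ∀ {x : Fin n} {p : Subset n} → x ∈ p → ∣ p ∣ ≡ suc ∣ p - x ∣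
∣p∣≡1+∣p-x∣ {p = inside ∷ p}  here          = cong (suc ∘ ∣_∣) (sym (p─⊥≡p p))
∣p∣≡1+∣p-x∣ {p = inside ∷ p}  (there x∈p)   = cong suc (∣p∣≡1+∣p-x∣ x∈p)
∣p∣≡1+∣p-x∣ {p = outside ∷ p} (there x∈p)   = ∣p∣≡1+∣p-x∣ x∈p

x∈p⇒1≤∣p∣ : ∀ {x} {p : Subset n} → x ∈ p → 1 ≤ ∣ p ∣
x∈p⇒1≤∣p∣ x∈p = subst (1 ≤_) (sym (∣p∣≡1+∣p-x∣ x∈p)) (s≤s z≤n)

x,y∈p⇒2≤∣p∣ : ∀ {x y} {p : Subset n} → x ≢ y → x ∈ p → y ∈ p → 2 ≤ ∣ p ∣
x,y∈p⇒2≤∣p∣ x≢y x∈p y∈p = subst (2 ≤_) (sym (∣p∣≡1+∣p-x∣ x∈p))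
  (s≤s (x∈p⇒1≤∣p∣ (x∈p∧x≢y⇒x∈p-y y∈p (x≢y ∘ sym))))

∣p∣≡∣p∩q∣+∣p─q∣ : ∀ (p q : Subset n) → ∣ p ∣ ≡ ∣ p ∩ q ∣ + ∣ p ─ q ∣
∣p∣≡∣p∩q∣+∣p─q∣ []            []            = refl
∣p∣≡∣p∩q∣+∣p─q∣ (outside ∷ p) (inside ∷ q)  = ∣p∣≡∣p∩q∣+∣p─q∣ p q
∣p∣≡∣p∩q∣+∣p─q∣ (outside ∷ p) (outside ∷ q) = ∣p∣≡∣p∩q∣+∣p─q∣ p q
∣p∣≡∣p∩q∣+∣p─q∣ (inside ∷ p)  (inside ∷ q)  = cong suc (∣p∣≡∣p∩q∣+∣p─q∣ p q)
∣p∣≡∣p∩q∣+∣p─q∣ (inside ∷ p)  (outside ∷ q) =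
  trans (cong suc (∣p∣≡∣p∩q∣+∣p─q∣ p q)) (sym (+-suc _ _))

∣p─p∣≡0 : ∀ (p : Subset n) → ∣ p ─ p ∣ ≡ 0
∣p─p∣≡0 {n} p = trans (cong ∣_∣ (Empty-unique λ (_ , x∈p─p) → x∉p─p p x∈p─p)) (∣⊥∣≡0 n)

0<∣p∣⇒Nonempty : ∀ {p : Subset n} → 0 < ∣ p ∣ → Nonempty p
0<∣p∣⇒Nonempty {n} {p} 0<∣p∣ with nonempty? p
... | yes ne = ne
... | no ¬ne = ⊥-elim (<⇒≢ 0<∣p∣ (sym (trans (cong ∣_∣ (Empty-unique ¬ne)) (∣⊥∣≡0 n))))

x∈q∖p⇒∣p∣<∣q∣ : ∀ {p q : Subset n} {x} → p ⊆ q → x ∈ q → x ∉ p → ∣ p ∣ < ∣ q ∣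
x∈q∖p⇒∣p∣<∣q∣ p⊆q x∈q x∉p = p⊂q⇒∣p∣<∣q∣ (p⊆q , _ , x∈q , x∉p)

x,y∈q∖p⇒2+∣p∣≤∣q∣ : ∀ {p q : Subset n} {x y} → p ⊆ q → x ≢ y → x ∈ q → y ∈ q → x ∉ p → y ∉ p →
          2 + ∣ p ∣ ≤ ∣ q ∣
x,y∈q∖p⇒2+∣p∣≤∣q∣ {p = p} {q} {x} {y} p⊆q x≢y x∈q y∈q x∉p y∉p = begin
  2 + ∣ p ∣       ≤⟨ s≤s (x∈q∖p⇒∣p∣<∣q∣ p⊆q-x (x∈p∧x≢y⇒x∈p-y y∈q (x≢y ∘ sym)) y∉p) ⟩
  suc ∣ q - x ∣   ≡⟨ ∣p∣≡1+∣p-x∣ x∈q ⟨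
  ∣ q ∣           ∎
  where
  open ≤-Reasoning
  p⊆q-x : p ⊆ q - x
  p⊆q-x {z} z∈p = x∈p∧x≢y⇒x∈p-y (p⊆q z∈p) (λ { refl → x∉p z∈p })

2≤∣p∣⇒two-elements : ∀ {p : Subset n} → 2 ≤ ∣ p ∣ → ∃₂ λ x y → x ≢ y × x ∈ p × y ∈ p
2≤∣p∣⇒two-elements {p = p} 2≤∣p∣
  with x , x∈p ← 0<∣p∣⇒Nonempty (≤-trans (s≤s z≤n) 2≤∣p∣)
  with y , y∈p-x ← 0<∣p∣⇒Nonempty {p = p - x} (s≤s⁻¹ (subst (2 ≤_) (∣p∣≡1+∣p-x∣ x∈p) 2≤∣p∣))
  with y∈p , y∉⁅x⁆ ← x∈p─q⁻ p ⁅ x ⁆ y∈p-x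
  = x , y , (λ { refl → y∉⁅x⁆ (x∈⁅x⁆ x) }) , x∈p , y∈p

module _ (G : Graph n) where

  isNonEdgeᵇ : Subset n → Fin n → Fin n → Bool
  isNonEdgeᵇ X u v = memᵇ X u ∧ memᵇ X v ∧ (toℕ u <ᵇ toℕ v) ∧ not (adj G u v)

  private
    isNonEdgeᵇ-mono : ∀ {X Y} → X ⊆ Y → ∀ u v → T (isNonEdgeᵇ X u v) → T (isNonEdgeᵇ Y u v)
    isNonEdgeᵇ-mono {X} X⊆Y u v ne
      with u∈X , ne′ ← Equivalence.to (T-∧ {memᵇ X u}) ne
      with v∈X , rest ← Equivalence.to (T-∧ {memᵇ X v}) ne′
      = Equivalence.from T-∧
          (∈⇒T (X⊆Y (T⇒∈ u∈X)) , Equivalence.from T-∧ (∈⇒T (X⊆Y (T⇒∈ v∈X)) , rest))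

    isNonEdgeᵇ-∈ : ∀ {X} u v → T (isNonEdgeᵇ X u v) → u ∈ X × v ∈ X
    isNonEdgeᵇ-∈ {X} u v ne with u∈X , ne′ ← Equivalence.to (T-∧ {memᵇ X u}) ne =
      T⇒∈ u∈X , T⇒∈ (proj₁ (Equivalence.to (T-∧ {memᵇ X v}) ne′))

  nonEdges-mono : ∀ {X Y} → X ⊆ Y → nonEdges G X ≤ nonEdges G Y
  nonEdges-mono X⊆Y =
    sum-map-mono (λ u → countᵇ-mono (isNonEdgeᵇ-mono X⊆Y u)) (allFin n)

  private
    isNonEdgeᵇ-intro : ∀ {X u v} → u ∈ X → v ∈ X → toℕ u < toℕ v → adj G u v ≡ false →
                       T (isNonEdgeᵇ X u v)
    isNonEdgeᵇ-intro u∈X v∈X u<v u≁v = Equivalence.from T-∧ (∈⇒T u∈X ,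
      Equivalence.from T-∧ (∈⇒T v∈X , Equivalence.from T-∧ (<⇒<ᵇ u<v , Equivalence.from T-not-≡ u≁v)))

    nonEdges-mono-<-at : ∀ {X Y} u v → X ⊆ Y → ¬ T (isNonEdgeᵇ X u v) → T (isNonEdgeᵇ Y u v) →
                         nonEdges G X < nonEdges G Y
    nonEdges-mono-<-at u v X⊆Y ∉X ∈Y = sum-map-mono-<
      (λ u′ → countᵇ-mono (isNonEdgeᵇ-mono X⊆Y u′)) (∈-allFin u)
      (countᵇ-mono-< (isNonEdgeᵇ-mono X⊆Y u) ∉X ∈Y)

  nonEdges-mono-< : ∀ {X Y x y} → X ⊆ Y → x ∈ X → y ∈ Y → y ∉ X → adj G x y ≡ false →
                    nonEdges G X < nonEdges G Y
  nonEdges-mono-< {X} {Y} {x} {y} X⊆Y x∈X y∈Y y∉X x≁y with <-cmp (toℕ x) (toℕ y)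
  ... | tri< x<y _ _ = nonEdges-mono-<-at x y X⊆Y
    (y∉X ∘ proj₂ ∘ isNonEdgeᵇ-∈ x y)
    (isNonEdgeᵇ-intro (X⊆Y x∈X) y∈Y x<y x≁y)
  ... | tri≈ _ x≡y _ = ⊥-elim (y∉X (subst (_∈ X) (toℕ-injective x≡y) x∈X))
  ... | tri> _ _ y<x = nonEdges-mono-<-at y x X⊆Y
    (y∉X ∘ proj₁ ∘ isNonEdgeᵇ-∈ y x)
    (isNonEdgeᵇ-intro y∈Y (X⊆Y x∈X) y<x (trans (Graph.sym G y x) x≁y))

  deg≡∣∩Nbr∣ : ∀ V u → deg G V u ≡ ∣ V ∩ Nbr G u ∣
  deg≡∣∩Nbr∣ V u = trans (countᵇ-cong lookup-∩) (countᵇ-lookup (V ∩ Nbr G u))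
    where
    lookup-∩ : ∀ v → lookup V v ∧ adj G u v ≡ lookup (V ∩ Nbr G u) v
    lookup-∩ v = sym (trans (lookup-zipWith _∧_ v V (Nbr G u))
                            (cong (lookup V v ∧_) (lookup∘tabulate (adj G u) v)))

  ∈Nbr⇒adj : ∀ {u v} → v ∈ Nbr G u → adj G u v ≡ true
  ∈Nbr⇒adj {u} {v} v∈ = trans (sym (lookup∘tabulate (adj G u) v)) ([]=⇒lookup v∈)

  ∉Nbr⇒nonadj : ∀ {u v} → v ∉ Nbr G u → adj G u v ≡ false
  ∉Nbr⇒nonadj {u} {v} v∉ with adj G u v in eq
  ... | false = refl
  ... | true  = ⊥-elim (v∉ (lookup⇒[]= v (Nbr G u) (trans (lookup∘tabulate (adj G u) v) eq)))

  non-neighbours : ∀ {V b} → b ∈ V → 3 + deg G V b ≤ ∣ V ∣ →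
                   ∃₂ λ u₁ u₂ → u₁ ≢ u₂ × u₁ ∈ V ─ Nbr G b - b × u₂ ∈ V ─ Nbr G b - b
  non-neighbours {V} {b} b∈V 3+deg≤∣V∣ = 2≤∣p∣⇒two-elements 2≤∣N-b∣
    where
    open ≤-Reasoning
    N = V ─ Nbr G b
    b∈N : b ∈ N
    b∈N = x∈p∧x∉q⇒x∈p─q b∈V λ b∈Nbr → case trans (sym (irrefl G b)) (∈Nbr⇒adj b∈Nbr) of λ ()
    3≤∣N∣ : 3 ≤ ∣ N ∣
    3≤∣N∣ = +-cancelʳ-≤ (deg G V b) 3 ∣ N ∣ (begin
      3 + deg G V b             ≤⟨ 3+deg≤∣V∣ ⟩
      ∣ V ∣                     ≡⟨ ∣p∣≡∣p∩q∣+∣p─q∣ V (Nbr G b) ⟩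
      ∣ V ∩ Nbr G b ∣ + ∣ N ∣   ≡⟨ cong (_+ ∣ N ∣) (deg≡∣∩Nbr∣ V b) ⟨
      deg G V b + ∣ N ∣         ≡⟨ +-comm (deg G V b) ∣ N ∣ ⟩
      ∣ N ∣ + deg G V b         ∎)
    2≤∣N-b∣ : 2 ≤ ∣ N - b ∣
    2≤∣N-b∣ = s≤s⁻¹ (subst (3 ≤_) (∣p∣≡1+∣p-x∣ b∈N) 3≤∣N∣)

∸2≰⇒3+≤ : ∀ {m d} → ¬ (m ∸ 2 ≤ d) → 3 + d ≤ m
∸2≰⇒3+≤ {0}           ¬≤ = ⊥-elim (¬≤ z≤n)
∸2≰⇒3+≤ {1}           ¬≤ = ⊥-elim (¬≤ z≤n)
∸2≰⇒3+≤ {suc (suc m)} ¬≤ = s≤s (s≤s (≰⇒> ¬≤))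

-- States of BB and pending vertices

_⊑_ : State {n} → State {n} → Set
(V′ , S′) ⊑ (V , S) = V′ ⊆ V × S ⊆ S′

⊑-refl : ∀ {st : State {n}} → st ⊑ st
⊑-refl = id , id

⊑-trans : ∀ {st₁ st₂ st₃ : State {n}} → st₁ ⊑ st₂ → st₂ ⊑ st₃ → st₁ ⊑ st₃
⊑-trans (V₁⊆V₂ , S₂⊆S₁) (V₂⊆V₃ , S₃⊆S₂) = V₂⊆V₃ ∘ V₁⊆V₂ , S₂⊆S₁ ∘ S₃⊆S₂

module _ {k : ℕ} {G : Graph n} where

  step-⊑ : ∀ {st st′} → Step k G st st′ → st′ ⊑ st
  step-⊑ (rr1 {V} u _ _ _)   = p─q⊆p V ⁅ u ⁆ , id
  step-⊑ (rr2 u _ _ _ _)     = id , p⊆p∪q ⁅ u ⁆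

  reduce-⊑ : ∀ {st st′} → Star (Step k G) st st′ → st′ ⊑ st
  reduce-⊑ ε          = ⊑-refl
  reduce-⊑ (step ◅ steps) = ⊑-trans (reduce-⊑ steps) (step-⊑ step)

─-⊑ : ∀ {V S V′ S′ : Subset n} → (V′ , S′) ⊑ (V , S) → V′ ─ S′ ⊆ V ─ S
─-⊑ (V′⊆V , S⊆S′) = ─-mono V′⊆V S⊆S′

─-∪⁅⁆ : ∀ (V S : Subset n) b → V ─ (S ∪ ⁅ b ⁆) ≡ V ─ S - b
─-∪⁅⁆ V S b = sym (p─q─r≡p─q∪r V S ⁅ b ⁆)

-─-comm : ∀ (V S : Subset n) b → (V - b) ─ S ≡ V ─ S - b
-─-comm V S b = p─q─r≡p─r─q V ⁅ b ⁆ S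

module _ (G : Graph n) where

  Pending : Subset n → Subset n → Fin n → Set
  Pending V S u = u ∈ V ─ S × HasNonNbr G S u

  data Pendings (V S : Subset n) : ℕ → Set where
    none : Pendings V S 0
    one  : ∀ {u} → Pending V S u → Pendings V S 1
    two  : ∀ {u₁ u₂} → u₁ ≢ u₂ → Pending V S u₁ → Pending V S u₂ → Pendings V S 2

  hasNonNbr-mono : ∀ {S S′ u} → S ⊆ S′ → HasNonNbr G S u → HasNonNbr G S′ u
  hasNonNbr-mono S⊆S′ (s , s∈S , u≁s) = s , S⊆S′ s∈S , u≁s

  module _ {V S : Subset n} where

    pendings≤2 : ∀ {p} → Pendings V S p → p ≤ 2
    pendings≤2 none        = z≤n
    pendings≤2 (one _)     = s≤s z≤n
    pendings≤2 (two _ _ _) = ≤-refl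

    pendings≤size : ∀ {p} → Pendings V S p → p ≤ ∣ V ─ S ∣
    pendings≤size none                          = z≤n
    pendings≤size (one (u∈ , _))                = x∈p⇒1≤∣p∣ u∈
    pendings≤size (two u₁≢u₂ (u₁∈ , _) (u₂∈ , _)) = x,y∈p⇒2≤∣p∣ u₁≢u₂ u₁∈ u₂∈

    module _ {V′ S′ : Subset n} (st′⊑st : (V′ , S′) ⊑ (V , S)) where

      private
        pending-mono : ∀ {u} → u ∈ V′ ─ S′ → Pending V S u → Pending V′ S′ u
        pending-mono u∈ (_ , nonNbr) = u∈ , hasNonNbr-mono (proj₂ st′⊑st) nonNbr

        D′⊆D = ─-⊑ st′⊑st

      pendings-reduce : ∀ {p} → Pendings V S p →
                        ∃ λ p′ → Pendings V′ S′ p′ × p + ∣ V′ ─ S′ ∣ ≤ p′ + ∣ V ─ S ∣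
      pendings-reduce none = 0 , none , p⊆q⇒∣p∣≤∣q∣ D′⊆D
      pendings-reduce (one {u} pu) with u ∈? V′ ─ S′
      ... | yes u∈ = 1 , one (pending-mono u∈ pu) , s≤s (p⊆q⇒∣p∣≤∣q∣ D′⊆D)
      ... | no u∉  = 0 , none , x∈q∖p⇒∣p∣<∣q∣ D′⊆D (proj₁ pu) u∉
      pendings-reduce (two {u₁} {u₂} u₁≢u₂ pu₁ pu₂) with u₁ ∈? V′ ─ S′ | u₂ ∈? V′ ─ S′
      ... | yes u₁∈ | yes u₂∈ =
        2 , two u₁≢u₂ (pending-mono u₁∈ pu₁) (pending-mono u₂∈ pu₂) , s≤s (s≤s (p⊆q⇒∣p∣≤∣q∣ D′⊆D))
      ... | yes u₁∈ | no u₂∉  = 1 , one (pending-mono u₁∈ pu₁) , s≤s (x∈q∖p⇒∣p∣<∣q∣ D′⊆D (proj₁ pu₂) u₂∉)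
      ... | no u₁∉  | yes u₂∈ = 1 , one (pending-mono u₂∈ pu₂) , s≤s (x∈q∖p⇒∣p∣<∣q∣ D′⊆D (proj₁ pu₁) u₁∉)
      ... | no u₁∉  | no u₂∉  = 0 , none , x,y∈q∖p⇒2+∣p∣≤∣q∣ D′⊆D u₁≢u₂ (proj₁ pu₁) (proj₁ pu₂) u₁∉ u₂∉

    pendings-child : ∀ {V₂ S₂ b p} → (∀ {u} → u ≢ b → Pending V S u → Pending V₂ S₂ u) →
                     Pendings V S p → Pendings V₂ S₂ (p ∸ 1)
    pendings-child keep none    = none
    pendings-child keep (one _) = none
    pendings-child {b = b} keep (two {u₁} {u₂} u₁≢u₂ pu₁ pu₂) with u₁ ≟ᶠ b
    ... | yes refl = one (keep (u₁≢u₂ ∘ sym) pu₂)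
    ... | no u₁≢b  = one (keep u₁≢b pu₁)

    pending-left : ∀ {b u} → u ≢ b → Pending V S u → Pending V (S ∪ ⁅ b ⁆) u
    pending-left {b} u≢b (u∈ , nonNbr) =
      subst (_ ∈_) (sym (─-∪⁅⁆ V S b)) (x∈p∧x≢y⇒x∈p-y u∈ u≢b) , hasNonNbr-mono (p⊆p∪q ⁅ b ⁆) nonNbr

    pending-right : ∀ {b u} → u ≢ b → Pending V S u → Pending (V - b) S u
    pending-right {b} u≢b (u∈ , nonNbr) =
      subst (_ ∈_) (sym (-─-comm V S b)) (x∈p∧x≢y⇒x∈p-y u∈ u≢b) , nonNbr

  fresh-pendings : ∀ {k V S b} → Irreducible k G (V , S) → b ∈ V → b ∉ S →
                   nonEdges G (S ∪ ⁅ b ⁆) ≤ k → ¬ HasNonNbr G S b →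
                   Pendings V (S ∪ ⁅ b ⁆) 2
  fresh-pendings {k} {V} {S} {b} irr b∈V b∉S ok ¬nonNbr
    with u₁ , u₂ , u₁≢u₂ , u₁∈ , u₂∈ ← non-neighbours G b∈V (∸2≰⇒3+≤ (irr _ ∘ rr2 b b∈V b∉S ok))
    = two u₁≢u₂ (pending u₁∈) (pending u₂∈)
    where
    pending : ∀ {u} → u ∈ V ─ Nbr G b - b → Pending V (S ∪ ⁅ b ⁆) u
    pending {u} u∈
      with u∈V─Nbr , u∉⁅b⁆ ← x∈p─q⁻ (V ─ Nbr G b) ⁅ b ⁆ u∈
      with u∈V , u∉Nbr ← x∈p─q⁻ V (Nbr G b) u∈V─Nbr
      = subst (u ∈_) (sym (─-∪⁅⁆ V S b))
          (x∈p∧x∉q⇒x∈p─q (x∈p∧x∉q⇒x∈p─q u∈V (¬nonNbr ∘ (u ,_) ∘ (_, b≁u))) u∉⁅b⁆)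
      , b , x∈p∪q⁺ (inj₂ (x∈⁅x⁆ b)) , trans (Graph.sym G u b) b≁u
      where
      b≁u = ∉Nbr⇒nonadj G u∉Nbr

-- Potentials

-- SearchTreeBound.run-bound shows that Ψ s t p / W s bounds the number of leaves below a state
-- with s undecided vertices, remaining non-edge budget t and p known pending vertices;
-- dividing by W lets Ψ take values in ℕ.
record Potential (k : ℕ) : Set where
  field
    Ψ : ℕ → ℕ → ℕ → ℕ
    W : ℕ → ℕ
    w : ℕ
    W-suc              : ∀ s → W (suc s) ≡ w * W s
    Ψ-leaf             : ∀ s t p → p ≤ s → p ≤ 2 → t ≤ k → W s ≤ Ψ s t p
    Ψ-branch-nonEdge   : ∀ s t p → p ≤ suc s → p ≤ 2 → suc t ≤ k →
                         w * (Ψ s t (p ∸ 1) + Ψ s (suc t) (p ∸ 1)) ≤ Ψ (suc s) (suc t) p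
    Ψ-branch-fresh     : ∀ s t → 2 ≤ s → t ≤ k → w * (Ψ s t 2 + Ψ s t 0) ≤ Ψ (suc s) t 0
    Ψ-reduce           : ∀ s t p → p ≤ suc s → p ≤ 2 → t ≤ k → w * Ψ s t (p ∸ 1) ≤ Ψ (suc s) t p
    Ψ-mono-budget      : ∀ s t p → p ≤ s → p ≤ 2 → suc t ≤ k → Ψ s t p ≤ Ψ s (suc t) p
    Ψ-antitone-pending : ∀ s t p → suc p ≤ s → suc p ≤ 2 → t ≤ k → Ψ s t (suc p) ≤ Ψ s t p

module PotentialProperties {k} (P : Potential k) where
  open Potential P
  open ≤-Reasoning

  Ψ-mono-budget-≤ : ∀ {s p t₁ t₂} → p ≤ s → p ≤ 2 → t₁ ≤ t₂ → t₂ ≤ k → Ψ s t₁ p ≤ Ψ s t₂ p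
  Ψ-mono-budget-≤ {t₂ = zero}   _   _   z≤n     _    = ≤-refl
  Ψ-mono-budget-≤ {t₂ = suc t₂} p≤s p≤2 t₁≤1+t₂ 1+t₂≤k with m≤n⇒m<n∨m≡n t₁≤1+t₂
  ... | inj₂ refl       = ≤-refl
  ... | inj₁ (s≤s t₁≤t₂) =
    ≤-trans (Ψ-mono-budget-≤ p≤s p≤2 t₁≤t₂ (≤-trans (n≤1+n t₂) 1+t₂≤k)) (Ψ-mono-budget _ t₂ _ p≤s p≤2 1+t₂≤k)

  Ψ-antitone-pending-≤ : ∀ {s t p₁ p₂} → p₁ ≤ s → p₁ ≤ 2 → p₂ ≤ p₁ → t ≤ k → Ψ s t p₁ ≤ Ψ s t p₂
  Ψ-antitone-pending-≤ {p₁ = zero}   _     _     z≤n     _   = ≤-refl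
  Ψ-antitone-pending-≤ {p₁ = suc p₁} 1+p₁≤s 1+p₁≤2 p₂≤1+p₁ t≤k with m≤n⇒m<n∨m≡n p₂≤1+p₁
  ... | inj₂ refl        = ≤-refl
  ... | inj₁ (s≤s p₂≤p₁) = ≤-trans (Ψ-antitone-pending _ _ p₁ 1+p₁≤s 1+p₁≤2 t≤k)
    (Ψ-antitone-pending-≤ (≤-trans (n≤1+n p₁) 1+p₁≤s) (≤-trans (n≤1+n p₁) 1+p₁≤2) p₂≤p₁ t≤k)

  *-W-suc : ∀ L s → L * W (suc s) ≡ w * (L * W s)
  *-W-suc L s = begin-equality
    L * W (suc s)   ≡⟨ cong (L *_) (W-suc s) ⟩
    L * (w * W s)   ≡⟨ x∙yz≈y∙xz L w (W s) ⟩
    w * (L * W s)   ∎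

  bound-undo-reductions : ∀ d {L t s p₁ p₂} → L * W s ≤ Ψ s t p₁ → p₁ ≤ s → p₁ ≤ 2 → p₂ ≤ 2 → t ≤ k →
               p₂ ≤ p₁ + d → L * W (d + s) ≤ Ψ (d + s) t p₂
  bound-undo-reductions zero {p₁ = p₁} bound p₁≤s p₁≤2 _ t≤k p₂≤p₁+0 =
    ≤-trans bound (Ψ-antitone-pending-≤ p₁≤s p₁≤2 (subst (_ ≤_) (+-identityʳ p₁) p₂≤p₁+0) t≤k)
  bound-undo-reductions (suc d) {L} {t} {s} {p₁} {p₂} bound p₁≤s p₁≤2 p₂≤2 t≤k p₂≤p₁+1+d = begin
    L * W (suc (d + s))       ≡⟨ *-W-suc L (d + s) ⟩
    w * (L * W (d + s))       ≤⟨ *-monoʳ-≤ w (bound-undo-reductions d {L} bound p₁≤s p₁≤2 p₂-1≤2 t≤k p₂-1≤p₁+d) ⟩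
    w * Ψ (d + s) t (p₂ ∸ 1)  ≤⟨ Ψ-reduce (d + s) t p₂ p₂≤1+d+s p₂≤2 t≤k ⟩
    Ψ (suc (d + s)) t p₂      ∎
    where
    p₂-1≤2 = ≤-trans (m∸n≤m p₂ 1) p₂≤2
    p₂-1≤p₁+d = ≤-trans (∸-monoˡ-≤ 1 p₂≤p₁+1+d) (≤-reflexive (+-∸-assoc p₁ (s≤s z≤n)))
    p₂≤1+d+s : p₂ ≤ suc (d + s)
    p₂≤1+d+s = ≤-trans p₂≤p₁+1+d (≤-trans (+-monoˡ-≤ (suc d) p₁≤s) (≤-reflexive (+-comm s (suc d))))

  +-*-W-suc : ∀ ℓ₁ ℓ₂ s → (ℓ₁ + ℓ₂) * W (suc s) ≡ w * (ℓ₁ * W s + ℓ₂ * W s)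
  +-*-W-suc ℓ₁ ℓ₂ s = trans (*-W-suc (ℓ₁ + ℓ₂) s) (cong (w *_) (*-distribʳ-+ (W s) ℓ₁ ℓ₂))

  bound-branch-nonEdge : ∀ {ℓ₁ ℓ₂ s t p} → ℓ₁ * W s ≤ Ψ s t (p ∸ 1) → ℓ₂ * W s ≤ Ψ s (suc t) (p ∸ 1) →
                         p ≤ suc s → p ≤ 2 → suc t ≤ k → (ℓ₁ + ℓ₂) * W (suc s) ≤ Ψ (suc s) (suc t) p
  bound-branch-nonEdge {ℓ₁} {ℓ₂} {s} {t} {p} bound₁ bound₂ p≤1+s p≤2 1+t≤k = begin
    (ℓ₁ + ℓ₂) * W (suc s)                         ≡⟨ +-*-W-suc ℓ₁ ℓ₂ s ⟩
    w * (ℓ₁ * W s + ℓ₂ * W s)                     ≤⟨ *-monoʳ-≤ w (+-mono-≤ bound₁ bound₂) ⟩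
    w * (Ψ s t (p ∸ 1) + Ψ s (suc t) (p ∸ 1))     ≤⟨ Ψ-branch-nonEdge s t p p≤1+s p≤2 1+t≤k ⟩
    Ψ (suc s) (suc t) p                           ∎

  bound-branch-fresh : ∀ {ℓ₁ ℓ₂ s t} → ℓ₁ * W s ≤ Ψ s t 2 → ℓ₂ * W s ≤ Ψ s t 0 →
                       2 ≤ s → t ≤ k → (ℓ₁ + ℓ₂) * W (suc s) ≤ Ψ (suc s) t 0
  bound-branch-fresh {ℓ₁} {ℓ₂} {s} {t} bound₁ bound₂ 2≤s t≤k = begin
    (ℓ₁ + ℓ₂) * W (suc s)       ≡⟨ +-*-W-suc ℓ₁ ℓ₂ s ⟩
    w * (ℓ₁ * W s + ℓ₂ * W s)   ≤⟨ *-monoʳ-≤ w (+-mono-≤ bound₁ bound₂) ⟩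
    w * (Ψ s t 2 + Ψ s t 0)     ≤⟨ Ψ-branch-fresh s t 2≤s t≤k ⟩
    Ψ (suc s) t 0               ∎

-- Search trees

module SearchTreeBound {k} (P : Potential k) {n} (G : Graph n) where
  open Potential P
  open PotentialProperties P

  Bounded : ℕ → ℕ → ℕ → ℕ → Set
  Bounded L s t p = L * W s ≤ Ψ s t p

  budget : Subset n → ℕ
  budget S = k ∸ nonEdges G S

  budget≤k : ∀ S → budget S ≤ k
  budget≤k S = m∸n≤m k (nonEdges G S)

  private
    bounded-budget : ∀ {L s t t′ p} → p ≤ s → p ≤ 2 → t ≤ t′ → t′ ≤ k →
                     Bounded L s t p → Bounded L s t′ p
    bounded-budget p≤s p≤2 t≤t′ t′≤k bound = ≤-trans bound (Ψ-mono-budget-≤ p≤s p≤2 t≤t′ t′≤k)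

    cast-size : ∀ {L t p} {D D′ : Subset n} → D ≡ D′ → Bounded L ∣ D ∣ t p → Bounded L ∣ D′ ∣ t p
    cast-size {L} {t} {p} = subst (λ D → Bounded L ∣ D ∣ t p)

    ≤k-of-irreducible : ∀ {V S b} → Irreducible k G (V , S) → b ∈ V → b ∉ S →
                        nonEdges G (S ∪ ⁅ b ⁆) ≤ k
    ≤k-of-irreducible irr b∈V b∉S = ≮⇒≥ (irr _ ∘ rr1 _ b∈V b∉S)

  bound-of-reduced : ∀ {V S V′ S′ L p} → (V′ , S′) ⊑ (V , S) → Pendings G V S p →
                 (∀ {p′} → Pendings G V′ S′ p′ → Bounded L ∣ V′ ─ S′ ∣ (budget S′) p′) →
                 Bounded L ∣ V ─ S ∣ (budget S) p
  bound-of-reduced {V} {S} {V′} {S′} {L} {p} st′⊑st ps bound′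
    with p′ , ps′ , p+s′≤p′+s ← pendings-reduce G st′⊑st ps
    = subst (λ s → Bounded L s (budget S) p) (m∸n+n≡m s′≤s)
        (bound-undo-reductions (s ∸ s′) {L} bound-budget p′≤s′ (pendings≤2 G ps′) (pendings≤2 G ps)
           (budget≤k S) p≤p′+d)
    where
    open ≤-Reasoning
    s = ∣ V ─ S ∣
    s′ = ∣ V′ ─ S′ ∣
    s′≤s : s′ ≤ s
    s′≤s = p⊆q⇒∣p∣≤∣q∣ (─-⊑ st′⊑st)
    p′≤s′ = pendings≤size G ps′
    bound-budget : Bounded L s′ (budget S) p′
    bound-budget = bounded-budget {L} p′≤s′ (pendings≤2 G ps′)
      (∸-monoʳ-≤ k (nonEdges-mono G (proj₂ st′⊑st))) (budget≤k S) (bound′ ps′)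
    p≤p′+d : p ≤ p′ + (s ∸ s′)
    p≤p′+d = +-cancelʳ-≤ s′ p (p′ + (s ∸ s′)) (begin
      p + s′                ≤⟨ p+s′≤p′+s ⟩
      p′ + s                ≡⟨ cong (p′ +_) (m∸n+n≡m s′≤s) ⟨
      p′ + (s ∸ s′ + s′)    ≡⟨ +-assoc p′ (s ∸ s′) s′ ⟨
      p′ + (s ∸ s′) + s′    ∎)

  mutual
    run-bound : ∀ {V S T p} → Run k G V S T → Pendings G V S p →
                Bounded (leaves T) ∣ V ─ S ∣ (budget S) p
    run-bound {S = S} (leafR _ _) ps = ≤-trans (≤-reflexive (*-identityˡ _))
      (Ψ-leaf _ _ _ (pendings≤size G ps) (pendings≤2 G ps) (budget≤k S))
    run-bound (nodeR {l = l} {r} b (steps , irr) _ b∈V b∉S br runₗ runᵣ) ps =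
      bound-of-reduced {L = leaves l + leaves r} (reduce-⊑ steps) ps (branch-bound irr b∈V b∉S br runₗ runᵣ)

    branch-bound : ∀ {V S b l r p} → Irreducible k G (V , S) → b ∈ V → b ∉ S → BR G V S b →
                   Run k G V (S ∪ ⁅ b ⁆) l → Run k G (V - b) S r → Pendings G V S p →
                   Bounded (leaves l + leaves r) ∣ V ─ S ∣ (budget S) p
    branch-bound {V} {S} {b} {l} {r} {p} irr b∈V b∉S (inj₁ (x , x∈S , b≁x)) runₗ runᵣ ps =
      subst₂ (λ s t → Bounded (leaves l + leaves r) s t p) (sym ∣D∣≡1+s₀) (sym budget≡1+t₀)
        (bound-branch-nonEdge {leaves l} boundₗ boundᵣ
          (subst (p ≤_) ∣D∣≡1+s₀ (pendings≤size G ps)) (pendings≤2 G ps)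
          (subst (_≤ k) budget≡1+t₀ (budget≤k S)))
      where
      s₀ = ∣ V ─ S - b ∣
      ∣D∣≡1+s₀ = ∣p∣≡1+∣p-x∣ (x∈p∧x∉q⇒x∈p─q b∈V b∉S)
      ne<ne∪b : nonEdges G S < nonEdges G (S ∪ ⁅ b ⁆)
      ne<ne∪b = nonEdges-mono-< G (p⊆p∪q ⁅ b ⁆) x∈S (x∈p∪q⁺ (inj₂ (x∈⁅x⁆ b))) b∉S
                  (trans (Graph.sym G x b) b≁x)
      t₀ = k ∸ suc (nonEdges G S)
      budget≡1+t₀ : budget S ≡ suc t₀
      budget≡1+t₀ = +-∸-assoc 1 (<-≤-trans ne<ne∪b (≤k-of-irreducible irr b∈V b∉S))
      psₗ = pendings-child G (pending-left G) ps
      psᵣ = pendings-child G (pending-right G) ps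
      p-1≤s₀ : p ∸ 1 ≤ s₀
      p-1≤s₀ = subst (λ D → p ∸ 1 ≤ ∣ D ∣) (-─-comm V S b) (pendings≤size G psᵣ)
      boundₗ : Bounded (leaves l) s₀ t₀ (p ∸ 1)
      boundₗ = bounded-budget {leaves l} p-1≤s₀ (pendings≤2 G psₗ) (∸-monoʳ-≤ k ne<ne∪b)
                 (≤-trans (n≤1+n t₀) (subst (_≤ k) budget≡1+t₀ (budget≤k S)))
                 (cast-size {leaves l} (─-∪⁅⁆ V S b) (run-bound runₗ psₗ))
      boundᵣ : Bounded (leaves r) s₀ (suc t₀) (p ∸ 1)
      boundᵣ = subst (λ t → Bounded (leaves r) s₀ t (p ∸ 1)) budget≡1+t₀
                 (cast-size {leaves r} (-─-comm V S b) (run-bound runᵣ psᵣ))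
    branch-bound {V} {S} {b} {l} {r} irr b∈V b∉S (inj₂ no-pending) runₗ runᵣ none =
      subst (λ s → Bounded (leaves l + leaves r) s (budget S) 0) (sym ∣D∣≡1+s₀)
        (bound-branch-fresh {leaves l} boundₗ boundᵣ 2≤s₀ (budget≤k S))
      where
      s₀ = ∣ V ─ S - b ∣
      ∣D∣≡1+s₀ = ∣p∣≡1+∣p-x∣ (x∈p∧x∉q⇒x∈p─q b∈V b∉S)
      psₗ = fresh-pendings G irr b∈V b∉S (≤k-of-irreducible irr b∈V b∉S) (no-pending b b∈V b∉S)
      2≤s₀ : 2 ≤ s₀
      2≤s₀ = subst (λ D → 2 ≤ ∣ D ∣) (─-∪⁅⁆ V S b) (pendings≤size G psₗ)
      boundₗ : Bounded (leaves l) s₀ (budget S) 2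
      boundₗ = bounded-budget {leaves l} 2≤s₀ ≤-refl
                 (∸-monoʳ-≤ k (nonEdges-mono G {S} (p⊆p∪q ⁅ b ⁆))) (budget≤k S)
                 (cast-size {leaves l} (─-∪⁅⁆ V S b) (run-bound runₗ psₗ))
      boundᵣ : Bounded (leaves r) s₀ (budget S) 0
      boundᵣ = cast-size {leaves r} (-─-comm V S b) (run-bound runᵣ none)
    branch-bound irr b∈V b∉S (inj₂ no-pending) _ _ (one (u∈ , nonNbr)) =
      ⊥-elim (uncurry (no-pending _) (x∈p─q⁻ _ _ u∈) nonNbr)
    branch-bound irr b∈V b∉S (inj₂ no-pending) _ _ (two _ (u∈ , nonNbr) _) =
      ⊥-elim (uncurry (no-pending _) (x∈p─q⁻ _ _ u∈) nonNbr)

-- Ψ s t p / W s = (E t p / K₀) (a / b) ^ (s ∸ p): growth by the ratio a / b per undecided vertex.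
record GeometricWeights (k : ℕ) : Set where
  field
    a b K₀ : ℕ
    E : ℕ → ℕ → ℕ
    1≤b : 1 ≤ b
    b≤a : b ≤ a
    E-leaf             : ∀ t p → t ≤ k → p ≤ 2 → K₀ ≤ E t p
    E-branch-nonEdge₀  : ∀ t → suc t ≤ k → b * (E t 0 + E (suc t) 0) ≤ a * E (suc t) 0
    E-branch-nonEdge   : ∀ t p → suc t ≤ k → p ≤ 1 → E t p + E (suc t) p ≤ E (suc t) (suc p)
    E-branch-fresh     : ∀ t → t ≤ k → b * b * b * E t 2 + b * E t 0 * (a * a) ≤ E t 0 * (a * a * a)
    E-reduce           : ∀ t p → t ≤ k → p ≤ 1 → E t p ≤ E t (suc p)
    E-mono-budget      : ∀ t p → suc t ≤ k → p ≤ 2 → E t p ≤ E (suc t) p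
    E-antitone-pending : ∀ t p → t ≤ k → p ≤ 1 → E t (suc p) * b ≤ E t p * a

module Geometric {k} (G : GeometricWeights k) where
  open GeometricWeights G
  open ≤-Reasoning

  Ψ : ℕ → ℕ → ℕ → ℕ
  Ψ s t p = E t p * (a ^ (s ∸ p) * b ^ p)

  W : ℕ → ℕ
  W s = K₀ * b ^ s

  W-suc : ∀ s → W (suc s) ≡ b * W s
  W-suc s = x∙yz≈y∙xz K₀ b (b ^ s)

  b^s≤a^[s-p]*b^p : ∀ s p → p ≤ s → b ^ s ≤ a ^ (s ∸ p) * b ^ p
  b^s≤a^[s-p]*b^p s p p≤s = begin
    b ^ s                  ≡⟨ cong (b ^_) (m∸n+n≡m p≤s) ⟨
    b ^ (s ∸ p + p)        ≡⟨ ^-distribˡ-+-* b (s ∸ p) p ⟩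
    b ^ (s ∸ p) * b ^ p    ≤⟨ *-monoˡ-≤ (b ^ p) (^-monoˡ-≤ (s ∸ p) b≤a) ⟩
    a ^ (s ∸ p) * b ^ p    ∎

  Ψ-leaf : ∀ s t p → p ≤ s → p ≤ 2 → t ≤ k → W s ≤ Ψ s t p
  Ψ-leaf s t p p≤s p≤2 t≤k = *-mono-≤ (E-leaf t p t≤k p≤2) (b^s≤a^[s-p]*b^p s p p≤s)

  Ψ-branch-nonEdge : ∀ s t p → p ≤ suc s → p ≤ 2 → suc t ≤ k →
                     b * (Ψ s t (p ∸ 1) + Ψ s (suc t) (p ∸ 1)) ≤ Ψ (suc s) (suc t) p
  Ψ-branch-nonEdge s t zero _ _ 1+t≤k = begin
    b * (E t 0 * (a ^ s * 1) + E (suc t) 0 * (a ^ s * 1))  ≡⟨ factor b (E t 0) (E (suc t) 0) (a ^ s) ⟩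
    (b * (E t 0 + E (suc t) 0)) * a ^ s                    ≤⟨ *-monoˡ-≤ (a ^ s) (E-branch-nonEdge₀ t 1+t≤k) ⟩
    (a * E (suc t) 0) * a ^ s                              ≡⟨ regroup a (E (suc t) 0) (a ^ s) ⟩
    E (suc t) 0 * (a * a ^ s * 1)                          ∎
    where
    factor : ∀ b x y z → b * (x * (z * 1) + y * (z * 1)) ≡ (b * (x + y)) * z
    factor = solve-∀
    regroup : ∀ a y z → (a * y) * z ≡ y * (a * z * 1)
    regroup = solve-∀
  Ψ-branch-nonEdge s t (suc p) _ 1+p≤2 1+t≤k = begin
    b * (E t p * (a ^ (s ∸ p) * b ^ p) + E (suc t) p * (a ^ (s ∸ p) * b ^ p))
      ≡⟨ factor b (E t p) (E (suc t) p) (a ^ (s ∸ p)) (b ^ p) ⟩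
    (E t p + E (suc t) p) * (a ^ (s ∸ p) * (b * b ^ p))
      ≤⟨ *-monoˡ-≤ _ (E-branch-nonEdge t p 1+t≤k (s≤s⁻¹ 1+p≤2)) ⟩
    E (suc t) (suc p) * (a ^ (s ∸ p) * (b * b ^ p))
      ∎
    where
    factor : ∀ b x y z u → b * (x * (z * u) + y * (z * u)) ≡ (x + y) * (z * (b * u))
    factor = solve-∀

  Ψ-branch-fresh : ∀ s t → 2 ≤ s → t ≤ k → b * (Ψ s t 2 + Ψ s t 0) ≤ Ψ (suc s) t 0
  Ψ-branch-fresh (suc zero)    t (s≤s ()) _
  Ψ-branch-fresh (suc (suc s)) t _ t≤k = begin
    b * (E t 2 * (a ^ s * (b * (b * 1))) + E t 0 * (a * (a * a ^ s) * 1))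
      ≡⟨ factor b a (E t 2) (E t 0) (a ^ s) ⟩
    (b * b * b * E t 2 + b * E t 0 * (a * a)) * a ^ s
      ≤⟨ *-monoˡ-≤ (a ^ s) (E-branch-fresh t t≤k) ⟩
    (E t 0 * (a * a * a)) * a ^ s
      ≡⟨ regroup a (E t 0) (a ^ s) ⟩
    E t 0 * (a * (a * (a * a ^ s)) * 1)
      ∎
    where
    factor : ∀ b a x y z → b * (x * (z * (b * (b * 1))) + y * (a * (a * z) * 1)) ≡
                           (b * b * b * x + b * y * (a * a)) * z
    factor = solve-∀
    regroup : ∀ a y z → (y * (a * a * a)) * z ≡ y * (a * (a * (a * z)) * 1)
    regroup = solve-∀

  Ψ-reduce : ∀ s t p → p ≤ suc s → p ≤ 2 → t ≤ k → b * Ψ s t (p ∸ 1) ≤ Ψ (suc s) t p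
  Ψ-reduce s t zero _ _ _ = begin
    b * (E t 0 * (a ^ s * 1))   ≡⟨ regroup b (E t 0) (a ^ s) ⟩
    E t 0 * (b * a ^ s * 1)     ≤⟨ *-monoʳ-≤ (E t 0) (*-monoˡ-≤ 1 (*-monoˡ-≤ (a ^ s) b≤a)) ⟩
    E t 0 * (a * a ^ s * 1)     ∎
    where
    regroup : ∀ b x z → b * (x * (z * 1)) ≡ x * (b * z * 1)
    regroup = solve-∀
  Ψ-reduce s t (suc p) _ 1+p≤2 t≤k = begin
    b * (E t p * (a ^ (s ∸ p) * b ^ p))       ≡⟨ regroup b (E t p) (a ^ (s ∸ p)) (b ^ p) ⟩
    E t p * (a ^ (s ∸ p) * (b * b ^ p))       ≤⟨ *-monoˡ-≤ _ (E-reduce t p t≤k (s≤s⁻¹ 1+p≤2)) ⟩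
    E t (suc p) * (a ^ (s ∸ p) * (b * b ^ p)) ∎
    where
    regroup : ∀ b x z u → b * (x * (z * u)) ≡ x * (z * (b * u))
    regroup = solve-∀

  Ψ-mono-budget : ∀ s t p → p ≤ s → p ≤ 2 → suc t ≤ k → Ψ s t p ≤ Ψ s (suc t) p
  Ψ-mono-budget s t p _ p≤2 1+t≤k = *-monoˡ-≤ _ (E-mono-budget t p 1+t≤k p≤2)

  Ψ-antitone-pending : ∀ s t p → suc p ≤ s → suc p ≤ 2 → t ≤ k → Ψ s t (suc p) ≤ Ψ s t p
  Ψ-antitone-pending s t p 1+p≤s 1+p≤2 t≤k = begin
    E t (suc p) * (a ^ (s ∸ suc p) * (b * b ^ p))    ≡⟨ regroup b (E t (suc p)) (a ^ (s ∸ suc p)) (b ^ p) ⟩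
    (E t (suc p) * b) * (a ^ (s ∸ suc p) * b ^ p)    ≤⟨ *-monoˡ-≤ _ (E-antitone-pending t p t≤k (s≤s⁻¹ 1+p≤2)) ⟩
    (E t p * a) * (a ^ (s ∸ suc p) * b ^ p)          ≡⟨ regroup′ a (E t p) (a ^ (s ∸ suc p)) (b ^ p) ⟩
    E t p * (a * a ^ (s ∸ suc p) * b ^ p)            ≡⟨ cong (λ e → E t p * (a ^ e * b ^ p)) (+-∸-assoc 1 1+p≤s) ⟨
    E t p * (a ^ (s ∸ p) * b ^ p)                    ∎
    where
    regroup : ∀ b x z u → x * (z * (b * u)) ≡ (x * b) * (z * u)
    regroup = solve-∀
    regroup′ : ∀ a x z u → (x * a) * (z * u) ≡ x * (a * z * u)
    regroup′ = solve-∀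

  potential : Potential k
  potential = record
    { Ψ = Ψ ; W = W ; w = b ; W-suc = W-suc
    ; Ψ-leaf = Ψ-leaf ; Ψ-branch-nonEdge = Ψ-branch-nonEdge ; Ψ-branch-fresh = Ψ-branch-fresh
    ; Ψ-reduce = Ψ-reduce ; Ψ-mono-budget = Ψ-mono-budget ; Ψ-antitone-pending = Ψ-antitone-pending
    }

  final : E k 0 < 2 * K₀ → ∀ s L → L * W s ≤ Ψ s k 0 → L * b ^ s < 2 * a ^ s
  final Ek0<2K₀ s L bound = *-cancelˡ-< K₀ (L * b ^ s) (2 * a ^ s) (begin-strict
    K₀ * (L * b ^ s)      ≡⟨ x∙yz≈y∙xz K₀ L (b ^ s) ⟩
    L * (K₀ * b ^ s)      ≤⟨ bound ⟩
    E k 0 * (a ^ s * 1)   ≡⟨ cong (E k 0 *_) (*-identityʳ (a ^ s)) ⟩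
    E k 0 * a ^ s         <⟨ *-monoˡ-< (a ^ s) {{a^s≢0}} Ek0<2K₀ ⟩
    2 * K₀ * a ^ s        ≡⟨ *-assoc 2 K₀ (a ^ s) ⟩
    2 * (K₀ * a ^ s)      ≡⟨ x∙yz≈y∙xz 2 K₀ (a ^ s) ⟩
    K₀ * (2 * a ^ s)      ∎)
    where
    a^s≢0 : NonZero (a ^ s)
    a^s≢0 = >-nonZero (m^n>0 a {{>-nonZero (≤-trans 1≤b b≤a)}} s)

-- x = a / b witnesses LtTwoBetaPow: pk<0 is p_k(x) < 0 multiplied by b^(k+2).
record Certificate (k : ℕ) : Set where
  field
    potential : Potential k
    a b       : ℕ
    1≤b       : 1 ≤ b
    b≤a       : b ≤ a
    pk<0      : a ^ (k + 2) + b ^ (k + 2) < 2 * a ^ (k + 1) * b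
    final     : ∀ s L → L * Potential.W potential s ≤ Potential.Ψ potential s k 0 → L * b ^ s < 2 * a ^ s

geometricCertificate : ∀ {k} (G : GeometricWeights k) → let open GeometricWeights G in
                       E k 0 < 2 * K₀ → a ^ (k + 2) + b ^ (k + 2) < 2 * a ^ (k + 1) * b → Certificate k
geometricCertificate G Ek0<2K₀ pk<0 = record
  { potential = potential ; a = a ; b = b ; 1≤b = 1≤b ; b≤a = b≤a ; pk<0 = pk<0 ; final = final Ek0<2K₀ }
  where
  open GeometricWeights G
  open Geometric G

-- E t p = A t * B p: each unit of budget multiplies A by (m+1)/m and each pending vertex
-- multiplies B by (2m+1)/(m+1).
module FamilyWeights (k m a b : ℕ) (1≤b : 1 ≤ b) (b≤a : b ≤ a)
  (a/b≥[2m+1]/[m+1] : b * (suc m + m) ≤ a * suc m)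
  (cubic : b * b * b * ((suc m + m) * (suc m + m)) + b * (suc m * suc m) * (a * a) ≤
           (suc m * suc m) * (a * a * a))
  ([1+1/m]^k<2 : suc m ^ k < 2 * m ^ k) where

  open ≤-Reasoning

  m⁺ : ℕ
  m⁺ = suc m

  A : ℕ → ℕ
  A t = m⁺ ^ t * m ^ (k ∸ t)

  B : ℕ → ℕ
  B zero          = m⁺ * m⁺
  B (suc zero)    = (m⁺ + m) * m⁺
  B (suc (suc _)) = (m⁺ + m) * (m⁺ + m)

  E : ℕ → ℕ → ℕ
  E t p = A t * B p

  A-suc : ∀ t → suc t ≤ k → A t * m⁺ ≡ A (suc t) * m
  A-suc t 1+t≤k rewrite +-∸-assoc 1 1+t≤k = regroup (m⁺ ^ t) m (m ^ (k ∸ suc t)) m⁺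
    where
    regroup : ∀ x y z u → x * (y * z) * u ≡ u * x * z * y
    regroup = solve-∀

  A-mono : ∀ t → suc t ≤ k → A t ≤ A (suc t)
  A-mono t 1+t≤k = *-cancelˡ-≤ m⁺ (begin
    m⁺ * A t          ≡⟨ *-comm m⁺ (A t) ⟩
    A t * m⁺          ≡⟨ A-suc t 1+t≤k ⟩
    A (suc t) * m     ≤⟨ *-monoʳ-≤ (A (suc t)) (n≤1+n m) ⟩
    A (suc t) * m⁺    ≡⟨ *-comm (A (suc t)) m⁺ ⟩
    m⁺ * A (suc t)    ∎)

  A0≤A : ∀ t → t ≤ k → A 0 ≤ A t
  A0≤A zero    _     = ≤-refl
  A0≤A (suc t) 1+t≤k = ≤-trans (A0≤A t (≤-trans (n≤1+n t) 1+t≤k)) (A-mono t 1+t≤k)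

  B-mono : ∀ p → B p ≤ B (suc p)
  B-mono zero          = *-monoˡ-≤ m⁺ (m≤m+n m⁺ m)
  B-mono (suc zero)    = *-monoʳ-≤ (m⁺ + m) (m≤m+n m⁺ m)
  B-mono (suc (suc p)) = ≤-refl

  B0≤B : ∀ p → B 0 ≤ B p
  B0≤B zero    = ≤-refl
  B0≤B (suc p) = ≤-trans (B0≤B p) (B-mono p)

  B-suc : ∀ p → p ≤ 1 → B (suc p) * m⁺ ≡ (m⁺ + m) * B p
  B-suc zero       _ = *-assoc (m⁺ + m) m⁺ m⁺
  B-suc (suc zero) _ = *-assoc (m⁺ + m) (m⁺ + m) m⁺
  B-suc (suc (suc p)) (s≤s ())

  m⁺*[A+A⁺] : ∀ t → suc t ≤ k → m⁺ * (A t + A (suc t)) ≡ A (suc t) * (m⁺ + m)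
  m⁺*[A+A⁺] t 1+t≤k = begin-equality
    m⁺ * (A t + A (suc t))            ≡⟨ *-distribˡ-+ m⁺ (A t) (A (suc t)) ⟩
    m⁺ * A t + m⁺ * A (suc t)         ≡⟨ cong (_+ m⁺ * A (suc t)) (trans (*-comm m⁺ (A t)) (A-suc t 1+t≤k)) ⟩
    A (suc t) * m + m⁺ * A (suc t)    ≡⟨ regroup (A (suc t)) m⁺ m ⟩
    A (suc t) * (m⁺ + m)              ∎
    where
    regroup : ∀ x y z → x * z + y * x ≡ x * (y + z)
    regroup = solve-∀

  E-leaf : ∀ t p → t ≤ k → p ≤ 2 → A 0 * B 0 ≤ E t p
  E-leaf t p t≤k _ = *-mono-≤ (A0≤A t t≤k) (B0≤B p)

  E-branch-nonEdge₀ : ∀ t → suc t ≤ k → b * (E t 0 + E (suc t) 0) ≤ a * E (suc t) 0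
  E-branch-nonEdge₀ t 1+t≤k = *-cancelˡ-≤ m⁺ (begin
    m⁺ * (b * (A t * B 0 + A (suc t) * B 0))  ≡⟨ regroup₁ m⁺ b (A t) (A (suc t)) (B 0) ⟩
    (m⁺ * (A t + A (suc t))) * (b * B 0)      ≡⟨ cong (_* (b * B 0)) (m⁺*[A+A⁺] t 1+t≤k) ⟩
    A (suc t) * (m⁺ + m) * (b * B 0)          ≡⟨ regroup₂ (A (suc t)) (m⁺ + m) b (B 0) ⟩
    (A (suc t) * B 0) * (b * (m⁺ + m))        ≤⟨ *-monoʳ-≤ (A (suc t) * B 0) a/b≥[2m+1]/[m+1] ⟩
    (A (suc t) * B 0) * (a * m⁺)              ≡⟨ regroup₃ (A (suc t) * B 0) a m⁺ ⟩
    m⁺ * (a * (A (suc t) * B 0))              ∎)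
    where
    regroup₁ : ∀ m b x y z → m * (b * (x * z + y * z)) ≡ (m * (x + y)) * (b * z)
    regroup₁ = solve-∀
    regroup₂ : ∀ x y b z → x * y * (b * z) ≡ (x * z) * (b * y)
    regroup₂ = solve-∀
    regroup₃ : ∀ x a m → x * (a * m) ≡ m * (a * x)
    regroup₃ = solve-∀

  E-branch-nonEdge : ∀ t p → suc t ≤ k → p ≤ 1 → E t p + E (suc t) p ≤ E (suc t) (suc p)
  E-branch-nonEdge t p 1+t≤k p≤1 = *-cancelˡ-≤ m⁺ (≤-reflexive (begin-equality
    m⁺ * (A t * B p + A (suc t) * B p)   ≡⟨ regroup₁ m⁺ (A t) (A (suc t)) (B p) ⟩
    (m⁺ * (A t + A (suc t))) * B p       ≡⟨ cong (_* B p) (m⁺*[A+A⁺] t 1+t≤k) ⟩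
    A (suc t) * (m⁺ + m) * B p           ≡⟨ *-assoc (A (suc t)) (m⁺ + m) (B p) ⟩
    A (suc t) * ((m⁺ + m) * B p)         ≡⟨ cong (A (suc t) *_) (B-suc p p≤1) ⟨
    A (suc t) * (B (suc p) * m⁺)         ≡⟨ regroup₂ (A (suc t)) (B (suc p)) m⁺ ⟩
    m⁺ * (A (suc t) * B (suc p))         ∎))
    where
    regroup₁ : ∀ m x y z → m * (x * z + y * z) ≡ (m * (x + y)) * z
    regroup₁ = solve-∀
    regroup₂ : ∀ x y m → x * (y * m) ≡ m * (x * y)
    regroup₂ = solve-∀

  E-branch-fresh : ∀ t → t ≤ k → b * b * b * E t 2 + b * E t 0 * (a * a) ≤ E t 0 * (a * a * a)
  E-branch-fresh t _ = begin
    b * b * b * (A t * B 2) + b * (A t * B 0) * (a * a)   ≡⟨ factor b (A t) (B 2) (B 0) a ⟩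
    A t * (b * b * b * B 2 + b * B 0 * (a * a))           ≤⟨ *-monoʳ-≤ (A t) cubic ⟩
    A t * (B 0 * (a * a * a))                             ≡⟨ *-assoc (A t) (B 0) (a * a * a) ⟨
    A t * B 0 * (a * a * a)                               ∎
    where
    factor : ∀ b x y z a → b * b * b * (x * y) + b * (x * z) * (a * a) ≡
                           x * (b * b * b * y + b * z * (a * a))
    factor = solve-∀

  E-reduce : ∀ t p → t ≤ k → p ≤ 1 → E t p ≤ E t (suc p)
  E-reduce t p _ _ = *-monoʳ-≤ (A t) (B-mono p)

  E-mono-budget : ∀ t p → suc t ≤ k → p ≤ 2 → E t p ≤ E (suc t) p
  E-mono-budget t p 1+t≤k _ = *-monoˡ-≤ (B p) (A-mono t 1+t≤k)

  E-antitone-pending : ∀ t p → t ≤ k → p ≤ 1 → E t (suc p) * b ≤ E t p * a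
  E-antitone-pending t zero _ _ = begin
    A t * ((m⁺ + m) * m⁺) * b     ≡⟨ regroup₁ (A t) (m⁺ + m) m⁺ b ⟩
    (A t * m⁺) * (b * (m⁺ + m))   ≤⟨ *-monoʳ-≤ (A t * m⁺) a/b≥[2m+1]/[m+1] ⟩
    (A t * m⁺) * (a * m⁺)         ≡⟨ regroup₂ (A t) m⁺ a ⟩
    A t * (m⁺ * m⁺) * a           ∎
    where
    regroup₁ : ∀ x y m b → x * (y * m) * b ≡ (x * m) * (b * y)
    regroup₁ = solve-∀
    regroup₂ : ∀ x m a → (x * m) * (a * m) ≡ x * (m * m) * a
    regroup₂ = solve-∀
  E-antitone-pending t (suc zero) _ _ = begin
    A t * ((m⁺ + m) * (m⁺ + m)) * b     ≡⟨ regroup₁ (A t) (m⁺ + m) b ⟩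
    (A t * (m⁺ + m)) * (b * (m⁺ + m))   ≤⟨ *-monoʳ-≤ (A t * (m⁺ + m)) a/b≥[2m+1]/[m+1] ⟩
    (A t * (m⁺ + m)) * (a * m⁺)         ≡⟨ regroup₂ (A t) (m⁺ + m) a m⁺ ⟩
    A t * ((m⁺ + m) * m⁺) * a           ∎
    where
    regroup₁ : ∀ x y b → x * (y * y) * b ≡ (x * y) * (b * y)
    regroup₁ = solve-∀
    regroup₂ : ∀ x y a m → (x * y) * (a * m) ≡ x * (y * m) * a
    regroup₂ = solve-∀
  E-antitone-pending t (suc (suc p)) _ (s≤s ())

  weights : GeometricWeights k
  weights = record
    { a = a ; b = b ; K₀ = A 0 * B 0 ; E = E ; 1≤b = 1≤b ; b≤a = b≤a
    ; E-leaf = E-leaf ; E-branch-nonEdge₀ = E-branch-nonEdge₀ ; E-branch-nonEdge = E-branch-nonEdge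
    ; E-branch-fresh = E-branch-fresh ; E-reduce = E-reduce ; E-mono-budget = E-mono-budget
    ; E-antitone-pending = E-antitone-pending
    }

  Ek0<2K₀ : E k 0 < 2 * (A 0 * B 0)
  Ek0<2K₀ = begin-strict
    m⁺ ^ k * m ^ (k ∸ k) * (m⁺ * m⁺)   ≡⟨ cong (λ e → m⁺ ^ k * m ^ e * (m⁺ * m⁺)) (n∸n≡0 k) ⟩
    m⁺ ^ k * 1 * (m⁺ * m⁺)             ≡⟨ cong (_* (m⁺ * m⁺)) (*-identityʳ (m⁺ ^ k)) ⟩
    m⁺ ^ k * (m⁺ * m⁺)                 <⟨ *-monoˡ-< (m⁺ * m⁺) [1+1/m]^k<2 ⟩
    2 * m ^ k * (m⁺ * m⁺)              ≡⟨ regroup (m ^ k) (m⁺ * m⁺) ⟩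
    2 * (1 * m ^ k * (m⁺ * m⁺))        ∎
    where
    regroup : ∀ x y → 2 * x * y ≡ 2 * (1 * x * y)
    regroup = solve-∀

familyCertificate : ∀ k m a b → 1 ≤ b → b ≤ a →
  b * (suc m + m) ≤ a * suc m →
  b * b * b * ((suc m + m) * (suc m + m)) + b * (suc m * suc m) * (a * a) ≤
    (suc m * suc m) * (a * a * a) →
  suc m ^ k < 2 * m ^ k →
  a ^ (k + 2) + b ^ (k + 2) < 2 * a ^ (k + 1) * b → Certificate k
familyCertificate k m a b 1≤b b≤a ratio cubic budget pk<0 = geometricCertificate weights Ek0<2K₀ pk<0
  where open FamilyWeights k m a b 1≤b b≤a ratio cubic budget

-- Certificates for each k

module _ {P : ℕ → Set} (P? : ∀ t → Dec (P t)) where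

  by-evaluation₁ : ∀ m → {True (allUpTo? P? m)} → ∀ t → t < m → P t
  by-evaluation₁ m {ok} t t<m = toWitness ok t<m

module _ {P : ℕ → ℕ → Set} (P? : ∀ t p → Dec (P t p)) where

  box? : ∀ m n → Dec (∀ {t} → t < m → ∀ {p} → p < n → P t p)
  box? m n = allUpTo? (λ t → allUpTo? (P? t) n) m

  by-evaluation₂ : ∀ m n → {True (box? m n)} → ∀ t p → t < m → p < n → P t p
  by-evaluation₂ m n {ok} t p t<m p<n = toWitness ok t<m p<n

module _ {P : ℕ → ℕ → ℕ → Set} (P? : ∀ s t p → Dec (P s t p)) where

  by-evaluation₃ : ∀ l m n → {True (allUpTo? (λ s → box? (P? s) m n) l)} →
                   ∀ s t p → s < l → t < m → p < n → P s t p
  by-evaluation₃ l m n {ok} s t p s<l t<m p<n = toWitness ok s<l t<m p<n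

E₂ : ℕ → ℕ → ℕ
E₂ zero          _             = 1945
E₂ (suc zero)    zero          = 2334
E₂ (suc zero)    (suc zero)    = 4279
E₂ (suc zero)    (suc (suc _)) = 6224
E₂ (suc (suc _)) zero          = 3672
E₂ (suc (suc _)) (suc zero)    = 6006
E₂ (suc (suc _)) (suc (suc _)) = 10285

weights₂ : GeometricWeights 2
weights₂ = record
  { a = 11 ; b = 6 ; K₀ = 1945 ; E = E₂ ; 1≤b = from-yes (1 ≤? 6) ; b≤a = from-yes (6 ≤? 11)
  ; E-leaf = λ t p t≤2 p≤2 →
      by-evaluation₂ (λ t p → 1945 ≤? E₂ t p) 3 3 t p (s≤s t≤2) (s≤s p≤2)
  ; E-branch-nonEdge₀ = λ t 1+t≤2 →
      by-evaluation₁ (λ t → 6 * (E₂ t 0 + E₂ (suc t) 0) ≤? 11 * E₂ (suc t) 0) 2 t 1+t≤2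
  ; E-branch-nonEdge = λ t p 1+t≤2 p≤1 →
      by-evaluation₂ (λ t p → E₂ t p + E₂ (suc t) p ≤? E₂ (suc t) (suc p)) 2 2 t p 1+t≤2 (s≤s p≤1)
  ; E-branch-fresh = λ t t≤2 →
      by-evaluation₁ (λ t → 6 * 6 * 6 * E₂ t 2 + 6 * E₂ t 0 * (11 * 11) ≤? E₂ t 0 * (11 * 11 * 11)) 3 t (s≤s t≤2)
  ; E-reduce = λ t p t≤2 p≤1 →
      by-evaluation₂ (λ t p → E₂ t p ≤? E₂ t (suc p)) 3 2 t p (s≤s t≤2) (s≤s p≤1)
  ; E-mono-budget = λ t p 1+t≤2 p≤2 →
      by-evaluation₂ (λ t p → E₂ t p ≤? E₂ (suc t) p) 2 3 t p 1+t≤2 (s≤s p≤2)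
  ; E-antitone-pending = λ t p t≤2 p≤1 →
      by-evaluation₂ (λ t p → E₂ t (suc p) * 6 ≤? E₂ t p * 11) 3 2 t p (s≤s t≤2) (s≤s p≤1)
  }

certificate₂ : Certificate 2
certificate₂ = geometricCertificate weights₂ (from-yes (3672 <? 2 * 1945))
  (from-yes (11 ^ 4 + 6 ^ 4 <? 2 * 11 ^ 3 * 6))

certificate₃ : Certificate 3
certificate₃ = familyCertificate 3 4 48 25 (from-yes (1 ≤? 25)) (from-yes (25 ≤? 48))
  (from-yes (25 * 9 ≤? 48 * 5))
  (from-yes (25 * 25 * 25 * (9 * 9) + 25 * (5 * 5) * (48 * 48) ≤? (5 * 5) * (48 * 48 * 48)))
  (from-yes (5 ^ 3 <? 2 * 4 ^ 3)) (from-yes (48 ^ 5 + 25 ^ 5 <? 2 * 48 ^ 4 * 25))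

-- (1 + 1/m)^j ≤ (m + 1)/(m + 1 - j), with denominators cleared
bernoulli : ∀ m j → j ≤ suc m → (suc m ∸ j) * suc m ^ j ≤ m ^ j * suc m
bernoulli m zero    _         = ≤-reflexive (*-comm (suc m) 1)
bernoulli m (suc j) (s≤s j≤m) = begin
  (m ∸ j) * (suc m * suc m ^ j)      ≡⟨ *-assoc (m ∸ j) (suc m) (suc m ^ j) ⟨
  ((m ∸ j) * suc m) * suc m ^ j      ≤⟨ *-monoˡ-≤ (suc m ^ j) c*[1+m]≤m*[1+c] ⟩
  (m * suc (m ∸ j)) * suc m ^ j      ≡⟨ *-assoc m (suc (m ∸ j)) (suc m ^ j) ⟩
  m * (suc (m ∸ j) * suc m ^ j)      ≡⟨ cong (λ c → m * (c * suc m ^ j)) (+-∸-assoc 1 j≤m) ⟨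
  m * ((suc m ∸ j) * suc m ^ j)      ≤⟨ *-monoʳ-≤ m (bernoulli m j (≤-trans j≤m (n≤1+n m))) ⟩
  m * (m ^ j * suc m)                ≡⟨ *-assoc m (m ^ j) (suc m) ⟨
  m * m ^ j * suc m                  ∎
  where
  open ≤-Reasoning
  c = m ∸ j
  c*[1+m]≤m*[1+c] : c * suc m ≤ m * suc c
  c*[1+m]≤m*[1+c] = begin
    c * suc m      ≡⟨ *-suc c m ⟩
    c + c * m      ≤⟨ +-monoˡ-≤ (c * m) (m∸n≤m m j) ⟩
    m + c * m      ≡⟨ cong (m +_) (*-comm c m) ⟩
    m + m * c      ≡⟨ *-suc m c ⟨
    m * suc c      ∎

^-distribʳ-* : ∀ x y n → (x * y) ^ n ≡ x ^ n * y ^ n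
^-distribʳ-* x y zero    = refl
^-distribʳ-* x y (suc n) rewrite ^-distribʳ-* x y n = interchange x y (x ^ n) (y ^ n)
  where
  interchange : ∀ x y u v → x * y * (u * v) ≡ x * u * (y * v)
  interchange = solve-∀

pk<0-of-2c-1 : ∀ k a c → suc a ≡ 2 * c → c ^ (k + 2) < a ^ (k + 1) →
               a ^ (k + 2) + c ^ (k + 2) < 2 * a ^ (k + 1) * c
pk<0-of-2c-1 k a c 1+a≡2c c^[k+2]<a^[k+1] = begin-strict
  a ^ (k + 2) + c ^ (k + 2)        <⟨ +-monoʳ-< (a ^ (k + 2)) c^[k+2]<a^[k+1] ⟩
  a ^ (k + 2) + a ^ (k + 1)        ≡⟨ cong (λ e → a ^ e + a ^ (k + 1)) (+-suc k 1) ⟩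
  a * a ^ (k + 1) + a ^ (k + 1)    ≡⟨ +-comm (a * a ^ (k + 1)) (a ^ (k + 1)) ⟩
  suc a * a ^ (k + 1)              ≡⟨ cong (_* a ^ (k + 1)) 1+a≡2c ⟩
  2 * c * a ^ (k + 1)              ≡⟨ swap c (a ^ (k + 1)) ⟩
  2 * a ^ (k + 1) * c              ∎
  where
  open ≤-Reasoning
  swap : ∀ c P → 2 * c * P ≡ 2 * P * c
  swap = solve-∀

-- For k = 4 + j the certificate uses m = 11 + 3j, b = 28 + 7j and a = 2b - 1, so that
-- a / b = 2 - 1/b lies just below β_k, which is roughly 2 - 2^-(k+1).
module k≥4 (j : ℕ) where

  open ≤-Reasoning

  k m a b : ℕ
  k = 4 + j
  m = 11 + 3 * j
  a = 55 + 14 * j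
  b = 28 + 7 * j

  1+a≡2b : suc a ≡ 2 * b
  1+a≡2b = lemma j
    where
    lemma : ∀ j → suc (55 + 14 * j) ≡ 2 * (28 + 7 * j)
    lemma = solve-∀

  [1+1/m]^k<2 : suc m ^ k < 2 * m ^ k
  [1+1/m]^k<2 = *-cancelˡ-< 2 X (2 * Y) (begin-strict
    2 * X     ≤⟨ 2X≤3Y ⟩
    3 * Y     <⟨ *-monoˡ-< Y {{>-nonZero (m^n>0 m k)}} (from-yes (3 <? 4)) ⟩
    4 * Y     ≡⟨ *-assoc 2 2 Y ⟩
    2 * (2 * Y) ∎)
    where
    X = suc m ^ k
    Y = m ^ k
    1+m-k≡8+2j : suc m ∸ k ≡ 8 + 2 * j
    1+m-k≡8+2j = trans (cong (_∸ k) (lemma j)) (m+n∸n≡m (8 + 2 * j) k)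
      where
      lemma : ∀ j → 12 + 3 * j ≡ (8 + 2 * j) + (4 + j)
      lemma = solve-∀
    k≤1+m : k ≤ suc m
    k≤1+m = +-monoʳ-≤ 4 (≤-trans (m≤n*m j 3) (m≤n+m (3 * j) 8))
    2X≤3Y : 2 * X ≤ 3 * Y
    2X≤3Y = *-cancelˡ-≤ k (subst₂ _≤_ (regroup₁ j X) (regroup₂ j Y)
              (subst (λ c → c * X ≤ Y * suc m) 1+m-k≡8+2j (bernoulli m k k≤1+m)))
      where
      regroup₁ : ∀ j X → (8 + 2 * j) * X ≡ (4 + j) * (2 * X)
      regroup₁ = solve-∀
      regroup₂ : ∀ j Y → Y * (12 + 3 * j) ≡ (4 + j) * (3 * Y)
      regroup₂ = solve-∀

  b²<[51+13j]*2^k : b * b < (51 + 13 * j) * 2 ^ k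
  b²<[51+13j]*2^k = go j
    where
    go : ∀ j → (28 + 7 * j) * (28 + 7 * j) < (51 + 13 * j) * 2 ^ (4 + j)
    go zero    = from-yes (784 <? 816)
    go (suc j) = begin-strict
      (28 + 7 * suc j) * (28 + 7 * suc j)
        ≤⟨ m≤m+n _ (343 + 294 * j + 49 * j * j) ⟩
      (28 + 7 * suc j) * (28 + 7 * suc j) + (343 + 294 * j + 49 * j * j)
        ≡⟨ lemma₁ j ⟩
      2 * ((28 + 7 * j) * (28 + 7 * j))
        <⟨ *-monoʳ-< 2 (go j) ⟩
      2 * ((51 + 13 * j) * 2 ^ (4 + j))
        ≤⟨ *-monoʳ-≤ 2 (*-monoˡ-≤ (2 ^ (4 + j)) (+-monoˡ-≤ (13 * j) (from-yes (51 ≤? 64)))) ⟩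
      2 * ((64 + 13 * j) * 2 ^ (4 + j))
        ≡⟨ lemma₂ j (2 ^ (4 + j)) ⟩
      (51 + 13 * suc j) * (2 * 2 ^ (4 + j))
        ∎
      where
      lemma₁ : ∀ j → (28 + 7 * suc j) * (28 + 7 * suc j) + (343 + 294 * j + 49 * j * j) ≡
                     2 * ((28 + 7 * j) * (28 + 7 * j))
      lemma₁ = solve-∀
      lemma₂ : ∀ j P → 2 * ((64 + 13 * j) * P) ≡ (51 + 13 * suc j) * (2 * P)
      lemma₂ = solve-∀

  pk<0 : a ^ (k + 2) + b ^ (k + 2) < 2 * a ^ (k + 1) * b
  pk<0 = pk<0-of-2c-1 k a b 1+a≡2b (begin-strict
    b ^ (k + 2)                     ≡⟨ ^-distribˡ-+-* b k 2 ⟩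
    b ^ k * (b * (b * 1))           ≡⟨ cong (λ x → b ^ k * (b * x)) (*-identityʳ b) ⟩
    b ^ k * (b * b)                 <⟨ *-monoʳ-< (b ^ k) {{>-nonZero (m^n>0 b k)}} b²<[51+13j]*2^k ⟩
    b ^ k * ((51 + 13 * j) * 2 ^ k) ≡⟨ regroup (b ^ k) (51 + 13 * j) (2 ^ k) ⟩
    (51 + 13 * j) * (2 ^ k * b ^ k) ≡⟨ cong ((51 + 13 * j) *_) (^-distribʳ-* 2 b k) ⟨
    (51 + 13 * j) * (2 * b) ^ k     ≡⟨ cong (λ x → (51 + 13 * j) * x ^ k) 1+a≡2b ⟨
    (51 + 13 * j) * suc a ^ k       ≤⟨ [51+13j][1+a]^k≤a^[k+1] ⟩
    a ^ (k + 1)                     ∎)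
    where
    regroup : ∀ x y z → x * (y * z) ≡ y * (z * x)
    regroup = solve-∀
    1+a-[k+1]≡51+13j : suc a ∸ (5 + j) ≡ 51 + 13 * j
    1+a-[k+1]≡51+13j = trans (cong (_∸ (5 + j)) (lemma j)) (m+n∸n≡m (51 + 13 * j) (5 + j))
      where
      lemma : ∀ j → 56 + 14 * j ≡ (51 + 13 * j) + (5 + j)
      lemma = solve-∀
    [51+13j][1+a]^k≤a^[k+1] : (51 + 13 * j) * suc a ^ k ≤ a ^ (k + 1)
    [51+13j][1+a]^k≤a^[k+1] = subst ((51 + 13 * j) * suc a ^ k ≤_) (cong (a ^_) (+-comm 1 k))
      (*-cancelˡ-≤ (suc a) (subst₂ _≤_ (regroup′ (51 + 13 * j) (suc a) (suc a ^ k)) (*-comm (a ^ (5 + j)) (suc a))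
        (subst (λ c → c * suc a ^ (5 + j) ≤ a ^ (5 + j) * suc a) 1+a-[k+1]≡51+13j
          (bernoulli a (5 + j) (+-monoʳ-≤ 5 (≤-trans (m≤n*m j 14) (m≤n+m (14 * j) 51)))))))
      where
      regroup′ : ∀ x y z → x * (y * z) ≡ y * (x * z)
      regroup′ = solve-∀

  a/b≥[2m+1]/[m+1] : b * (suc m + m) ≤ a * suc m
  a/b≥[2m+1]/[m+1] = subst (b * (suc m + m) ≤_) (sym (lemma j)) (m≤m+n (b * (suc m + m)) (16 + 4 * j))
    where
    lemma : ∀ j → (55 + 14 * j) * (12 + 3 * j) ≡ (28 + 7 * j) * ((12 + 3 * j) + (11 + 3 * j)) + (16 + 4 * j)
    lemma = solve-∀

  -- With X = (m+1) a, Y = (2m+1) b and X = Y + d, the condition reads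
  -- b Y² + b X² ≤ a X², which follows from X² ≤ b d (X + Y) since a + 1 = 2b.
  cubic : b * b * b * ((suc m + m) * (suc m + m)) + b * (suc m * suc m) * (a * a) ≤
          (suc m * suc m) * (a * a * a)
  cubic = subst₂ _≤_ (regroup₁ b (suc m + m) (suc m) a) (regroup₂ (suc m) a)
    (+-cancelʳ-≤ (X * X) _ _ (begin
      b * (Y * Y) + b * (X * X) + X * X            ≤⟨ +-monoʳ-≤ (b * (Y * Y) + b * (X * X)) X²≤bd[X+Y] ⟩
      b * (Y * Y) + b * (X * X) + b * d * (X + Y)  ≡⟨ cong (λ x → b * (Y * Y) + b * (x * x) + b * d * (x + Y)) X≡Y+d ⟩
      b * (Y * Y) + b * ((Y + d) * (Y + d)) + b * d * ((Y + d) + Y)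
                                                   ≡⟨ square b Y d ⟩
      2 * b * ((Y + d) * (Y + d))                  ≡⟨ cong (λ x → x * ((Y + d) * (Y + d))) 1+a≡2b ⟨
      suc a * ((Y + d) * (Y + d))                  ≡⟨ cong (λ x → suc a * (x * x)) X≡Y+d ⟨
      suc a * (X * X)                              ≡⟨ +-comm (X * X) (a * (X * X)) ⟩
      a * (X * X) + X * X                          ≡⟨ cong (_+ X * X) (*-comm a (X * X)) ⟩
      X * X * a + X * X                            ∎))
    where
    X = suc m * a
    Y = b * (suc m + m)
    d = 16 + 4 * j
    P = (4 + j) * (4 + j)
    X≡Y+d : X ≡ Y + d
    X≡Y+d = lemma j
      where
      lemma : ∀ j → (12 + 3 * j) * (55 + 14 * j) ≡ (28 + 7 * j) * ((12 + 3 * j) + (11 + 3 * j)) + (16 + 4 * j)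
      lemma = solve-∀
    X≤42P : X ≤ 42 * P
    X≤42P = subst (X ≤_) (lemma j) (m≤m+n X (12 + 3 * j))
      where
      lemma : ∀ j → (12 + 3 * j) * (55 + 14 * j) + (12 + 3 * j) ≡ 42 * ((4 + j) * (4 + j))
      lemma = solve-∀
    63P≤X+Y : 63 * P ≤ X + Y
    63P≤X+Y = subst (63 * P ≤_) (lemma j) (m≤m+n (63 * P) _)
      where
      lemma : ∀ j → 63 * ((4 + j) * (4 + j)) + (296 + 158 * j + 21 * (j * j)) ≡
                    (12 + 3 * j) * (55 + 14 * j) + (28 + 7 * j) * ((12 + 3 * j) + (11 + 3 * j))
      lemma = solve-∀
    X²≤bd[X+Y] : X * X ≤ b * d * (X + Y)
    X²≤bd[X+Y] = begin
      X * X                ≤⟨ *-mono-≤ X≤42P X≤42P ⟩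
      (42 * P) * (42 * P)  ≡⟨ lemma₁ P ⟩
      (28 * P) * (63 * P)  ≤⟨ *-monoʳ-≤ (28 * P) 63P≤X+Y ⟩
      (28 * P) * (X + Y)   ≡⟨ cong (_* (X + Y)) (lemma₂ j) ⟨
      b * d * (X + Y)      ∎
      where
      lemma₁ : ∀ P → (42 * P) * (42 * P) ≡ (28 * P) * (63 * P)
      lemma₁ = solve-∀
      lemma₂ : ∀ j → (28 + 7 * j) * (16 + 4 * j) ≡ 28 * ((4 + j) * (4 + j))
      lemma₂ = solve-∀
    square : ∀ b Y d → b * (Y * Y) + b * ((Y + d) * (Y + d)) + b * d * ((Y + d) + Y) ≡
                       2 * b * ((Y + d) * (Y + d))
    square = solve-∀
    regroup₁ : ∀ b u m a → b * ((b * u) * (b * u)) + b * ((m * a) * (m * a)) ≡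
                           b * b * b * (u * u) + b * (m * m) * (a * a)
    regroup₁ = solve-∀
    regroup₂ : ∀ m a → (m * a) * (m * a) * a ≡ (m * m) * (a * a * a)
    regroup₂ = solve-∀

  certificate : Certificate k
  certificate = familyCertificate k m a b (s≤s z≤n) b≤a a/b≥[2m+1]/[m+1] cubic [1+1/m]^k<2 pk<0
    where
    b≤a : b ≤ a
    b≤a = subst (b ≤_) (sym (lemma j)) (m≤m+n b (27 + 7 * j))
      where
      lemma : ∀ j → 55 + 14 * j ≡ (28 + 7 * j) + (27 + 7 * j)
      lemma = solve-∀

module k≡1 where

  open ≤-Reasoning

  E₁ : ℕ → ℕ → ℕ
  E₁ zero    _             = 1
  E₁ (suc _) zero          = 16
  E₁ (suc _) (suc zero)    = 17
  E₁ (suc _) (suc (suc _)) = 18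

  weights₁ : GeometricWeights 1
  weights₁ = record
    { a = 3 ; b = 2 ; K₀ = 1 ; E = E₁ ; 1≤b = from-yes (1 ≤? 2) ; b≤a = from-yes (2 ≤? 3)
    ; E-leaf = λ t p t≤1 p≤2 →
        by-evaluation₂ (λ t p → 1 ≤? E₁ t p) 2 3 t p (s≤s t≤1) (s≤s p≤2)
    ; E-branch-nonEdge₀ = λ t 1+t≤1 →
        by-evaluation₁ (λ t → 2 * (E₁ t 0 + E₁ (suc t) 0) ≤? 3 * E₁ (suc t) 0) 1 t 1+t≤1
    ; E-branch-nonEdge = λ t p 1+t≤1 p≤1 →
        by-evaluation₂ (λ t p → E₁ t p + E₁ (suc t) p ≤? E₁ (suc t) (suc p)) 1 2 t p 1+t≤1 (s≤s p≤1)
    ; E-branch-fresh = λ t t≤1 →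
        by-evaluation₁ (λ t → 2 * 2 * 2 * E₁ t 2 + 2 * E₁ t 0 * (3 * 3) ≤? E₁ t 0 * (3 * 3 * 3)) 2 t (s≤s t≤1)
    ; E-reduce = λ t p t≤1 p≤1 →
        by-evaluation₂ (λ t p → E₁ t p ≤? E₁ t (suc p)) 2 2 t p (s≤s t≤1) (s≤s p≤1)
    ; E-mono-budget = λ t p 1+t≤1 p≤2 →
        by-evaluation₂ (λ t p → E₁ t p ≤? E₁ (suc t) p) 1 3 t p 1+t≤1 (s≤s p≤2)
    ; E-antitone-pending = λ t p t≤1 p≤1 →
        by-evaluation₂ (λ t p → E₁ t (suc p) * 2 ≤? E₁ t p * 3) 2 2 t p (s≤s t≤1) (s≤s p≤1)
    }

  module Tail₁ = Geometric weights₁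
  open Tail₁ using (W; W-suc) renaming (Ψ to Ψtail)

  nth : List ℕ → ℕ → ℕ
  nth []       _       = 0
  nth (x ∷ xs) zero    = x
  nth (x ∷ xs) (suc i) = nth xs i

  -- D s t p is the least solution, for s < 29, of the inequalities Ψ-leaf, Ψ-branch-nonEdge,
  -- Ψ-branch-fresh and Ψ-reduce with Ψ s t p = D s t p * 2^s and w = 2 (D s t p = 0 for p > s).
  D : ℕ → ℕ → ℕ → ℕ
  D s zero    zero          = nth
    (1 ∷ 1 ∷ 1 ∷ 2 ∷ 3 ∷ 4 ∷ 6 ∷ 9 ∷ 13 ∷ 19 ∷ 28 ∷ 41 ∷ 60 ∷ 88 ∷ 129 ∷
     189 ∷ 277 ∷ 406 ∷ 595 ∷ 872 ∷ 1278 ∷ 1873 ∷ 2745 ∷ 4023 ∷ 5896 ∷ 8641 ∷ 12664 ∷ 18560 ∷ 27201 ∷ []) s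
  D s zero    (suc zero)    = nth
    (0 ∷ 1 ∷ 1 ∷ 1 ∷ 2 ∷ 3 ∷ 4 ∷ 6 ∷ 9 ∷ 13 ∷ 19 ∷ 28 ∷ 41 ∷ 60 ∷ 88 ∷
     129 ∷ 189 ∷ 277 ∷ 406 ∷ 595 ∷ 872 ∷ 1278 ∷ 1873 ∷ 2745 ∷ 4023 ∷ 5896 ∷ 8641 ∷ 12664 ∷ 18560 ∷ []) s
  D s zero    (suc (suc _)) = nth
    (0 ∷ 0 ∷ 1 ∷ 1 ∷ 1 ∷ 2 ∷ 3 ∷ 4 ∷ 6 ∷ 9 ∷ 13 ∷ 19 ∷ 28 ∷ 41 ∷ 60 ∷
     88 ∷ 129 ∷ 189 ∷ 277 ∷ 406 ∷ 595 ∷ 872 ∷ 1278 ∷ 1873 ∷ 2745 ∷ 4023 ∷ 5896 ∷ 8641 ∷ 12664 ∷ []) s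
  D s (suc _) zero          = nth
    (1 ∷ 2 ∷ 3 ∷ 6 ∷ 10 ∷ 15 ∷ 25 ∷ 41 ∷ 64 ∷ 101 ∷ 160 ∷ 250 ∷ 389 ∷ 605 ∷ 937 ∷
     1446 ∷ 2227 ∷ 3422 ∷ 5246 ∷ 8027 ∷ 12261 ∷ 18697 ∷ 28468 ∷ 43285 ∷ 65728 ∷ 99686 ∷ 151017 ∷ 228537 ∷ 345505 ∷ []) s
  D s (suc _) (suc zero)    = nth
    (0 ∷ 2 ∷ 3 ∷ 4 ∷ 8 ∷ 13 ∷ 19 ∷ 31 ∷ 50 ∷ 77 ∷ 120 ∷ 188 ∷ 291 ∷ 449 ∷ 693 ∷
     1066 ∷ 1635 ∷ 2504 ∷ 3828 ∷ 5841 ∷ 8899 ∷ 13539 ∷ 20570 ∷ 31213 ∷ 47308 ∷ 71624 ∷ 108327 ∷ 163681 ∷ 247097 ∷ []) s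
  D s (suc _) (suc (suc _)) = nth
    (0 ∷ 0 ∷ 3 ∷ 4 ∷ 5 ∷ 10 ∷ 16 ∷ 23 ∷ 37 ∷ 59 ∷ 90 ∷ 139 ∷ 216 ∷ 332 ∷ 509 ∷
     781 ∷ 1195 ∷ 1824 ∷ 2781 ∷ 4234 ∷ 6436 ∷ 9771 ∷ 14817 ∷ 22443 ∷ 33958 ∷ 51331 ∷ 77520 ∷ 116968 ∷ 176345 ∷ []) s

  D-leaf : ∀ s t p → s < 29 → t ≤ 1 → p ≤ 2 → p ≤ s → 1 ≤ D s t p
  D-leaf s t p s<29 t≤1 p≤2 =
    by-evaluation₃ (λ s t p → p ≤? s →-dec 1 ≤? D s t p)
      29 2 3 s t p s<29 (s≤s t≤1) (s≤s p≤2)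

  D-branch-nonEdge : ∀ s p → suc s < 29 → p ≤ 2 → p ≤ suc s →
                     D s 0 (p ∸ 1) + D s 1 (p ∸ 1) ≤ D (suc s) 1 p
  D-branch-nonEdge s p 1+s<29 p≤2 =
    by-evaluation₂ (λ s p → p ≤? suc s →-dec D s 0 (p ∸ 1) + D s 1 (p ∸ 1) ≤? D (suc s) 1 p)
      28 3 s p (s≤s⁻¹ 1+s<29) (s≤s p≤2)

  D-branch-fresh : ∀ s t → suc s < 29 → t ≤ 1 → 2 ≤ s → D s t 2 + D s t 0 ≤ D (suc s) t 0
  D-branch-fresh s t 1+s<29 t≤1 =
    by-evaluation₂ (λ s t → 2 ≤? s →-dec D s t 2 + D s t 0 ≤? D (suc s) t 0)
      28 2 s t (s≤s⁻¹ 1+s<29) (s≤s t≤1)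

  D-reduce : ∀ s t p → suc s < 29 → t ≤ 1 → p ≤ 2 → p ≤ suc s → D s t (p ∸ 1) ≤ D (suc s) t p
  D-reduce s t p 1+s<29 t≤1 p≤2 =
    by-evaluation₃ (λ s t p → p ≤? suc s →-dec D s t (p ∸ 1) ≤? D (suc s) t p)
      28 2 3 s t p (s≤s⁻¹ 1+s<29) (s≤s t≤1) (s≤s p≤2)

  D-mono-budget : ∀ s p → s < 29 → p ≤ 2 → p ≤ s → D s 0 p ≤ D s 1 p
  D-mono-budget s p s<29 p≤2 =
    by-evaluation₂ (λ s p → p ≤? s →-dec D s 0 p ≤? D s 1 p)
      29 3 s p s<29 (s≤s p≤2)

  D-antitone-pending : ∀ s t p → s < 29 → t ≤ 1 → suc p ≤ 2 → suc p ≤ s → D s t (suc p) ≤ D s t p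
  D-antitone-pending s t p s<29 t≤1 1+p≤2 =
    by-evaluation₃ (λ s t p → suc p ≤? s →-dec D s t (suc p) ≤? D s t p)
      29 2 2 s t p s<29 (s≤s t≤1) 1+p≤2

  D≤tail : ∀ s t p → s < 29 → t ≤ 1 → p ≤ 2 → p ≤ s → D s t p * W s ≤ Ψtail s t p
  D≤tail s t p s<29 t≤1 p≤2 =
    by-evaluation₃ (λ s t p → p ≤? s →-dec D s t p * (1 * 2 ^ s) ≤? Ψtail s t p)
      29 2 3 s t p s<29 (s≤s t≤1) (s≤s p≤2)

  D-final : ∀ s → s < 29 → D s 1 0 * 200 ^ s < 2 * 323 ^ s
  D-final = by-evaluation₁ (λ s → D s 1 0 * 200 ^ s <? 2 * 323 ^ s) 29

  Ψ₁ : ℕ → ℕ → ℕ → ℕ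
  Ψ₁ s t p = if s <ᵇ 29 then D s t p * W s else Ψtail s t p

  Ψ₁-table : ∀ s t p → s < 29 → Ψ₁ s t p ≡ D s t p * W s
  Ψ₁-table s t p s<29 with s <ᵇ 29 in eq
  ... | true  = refl
  ... | false = ⊥-elim (subst T eq (<⇒<ᵇ s<29))

  Ψ₁-tail : ∀ s t p → 29 ≤ s → Ψ₁ s t p ≡ Ψtail s t p
  Ψ₁-tail s t p 29≤s with s <ᵇ 29 in eq
  ... | false = refl
  ... | true  = ⊥-elim (<⇒≱ (<ᵇ⇒< s 29 (subst T (sym eq) _)) 29≤s)

  Ψ₁≤tail : ∀ s t p → t ≤ 1 → p ≤ 2 → p ≤ s → Ψ₁ s t p ≤ Ψtail s t p
  Ψ₁≤tail s t p t≤1 p≤2 p≤s with s <? 29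
  ... | yes s<29 = subst (_≤ Ψtail s t p) (sym (Ψ₁-table s t p s<29)) (D≤tail s t p s<29 t≤1 p≤2 p≤s)
  ... | no  s≮29 = ≤-reflexive (Ψ₁-tail s t p (≮⇒≥ s≮29))

  private
    2*W : ∀ x s → 2 * (x * W s) ≡ x * W (suc s)
    2*W x s = trans (x∙yz≈y∙xz 2 x (W s)) (cong (x *_) (sym (W-suc s)))

    2*[W+W] : ∀ x y s → 2 * (x * W s + y * W s) ≡ (x + y) * W (suc s)
    2*[W+W] x y s = trans (cong (2 *_) (sym (*-distribʳ-+ (W s) x y))) (2*W (x + y) s)

  Ψ₁-leaf : ∀ s t p → p ≤ s → p ≤ 2 → t ≤ 1 → W s ≤ Ψ₁ s t p
  Ψ₁-leaf s t p p≤s p≤2 t≤1 with s <? 29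
  ... | yes s<29 = subst (W s ≤_) (sym (Ψ₁-table s t p s<29))
    (≤-trans (≤-reflexive (sym (*-identityˡ (W s)))) (*-monoˡ-≤ (W s) (D-leaf s t p s<29 t≤1 p≤2 p≤s)))
  ... | no  s≮29 = subst (W s ≤_) (sym (Ψ₁-tail s t p (≮⇒≥ s≮29))) (Tail₁.Ψ-leaf s t p p≤s p≤2 t≤1)

  Ψ₁-branch-nonEdge : ∀ s t p → p ≤ suc s → p ≤ 2 → suc t ≤ 1 →
                      2 * (Ψ₁ s t (p ∸ 1) + Ψ₁ s (suc t) (p ∸ 1)) ≤ Ψ₁ (suc s) (suc t) p
  Ψ₁-branch-nonEdge s zero p p≤1+s p≤2 1+t≤1 with suc s <? 29
  ... | yes 1+s<29 = begin
    2 * (Ψ₁ s 0 (p ∸ 1) + Ψ₁ s 1 (p ∸ 1))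
      ≡⟨ cong₂ (λ x y → 2 * (x + y)) (Ψ₁-table s 0 (p ∸ 1) s<29) (Ψ₁-table s 1 (p ∸ 1) s<29) ⟩
    2 * (D s 0 (p ∸ 1) * W s + D s 1 (p ∸ 1) * W s)
      ≡⟨ 2*[W+W] (D s 0 (p ∸ 1)) (D s 1 (p ∸ 1)) s ⟩
    (D s 0 (p ∸ 1) + D s 1 (p ∸ 1)) * W (suc s)
      ≤⟨ *-monoˡ-≤ (W (suc s)) (D-branch-nonEdge s p 1+s<29 p≤2 p≤1+s) ⟩
    D (suc s) 1 p * W (suc s)
      ≡⟨ Ψ₁-table (suc s) 1 p 1+s<29 ⟨
    Ψ₁ (suc s) 1 p
      ∎
    where s<29 = <-trans (n<1+n s) 1+s<29
  ... | no 1+s≮29 = begin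
    2 * (Ψ₁ s 0 (p ∸ 1) + Ψ₁ s 1 (p ∸ 1))
      ≤⟨ *-monoʳ-≤ 2 (+-mono-≤ (Ψ₁≤tail s 0 (p ∸ 1) z≤n p-1≤2 p-1≤s) (Ψ₁≤tail s 1 (p ∸ 1) ≤-refl p-1≤2 p-1≤s)) ⟩
    2 * (Ψtail s 0 (p ∸ 1) + Ψtail s 1 (p ∸ 1))
      ≤⟨ Tail₁.Ψ-branch-nonEdge s 0 p p≤1+s p≤2 1+t≤1 ⟩
    Ψtail (suc s) 1 p
      ≡⟨ Ψ₁-tail (suc s) 1 p (≮⇒≥ 1+s≮29) ⟨
    Ψ₁ (suc s) 1 p
      ∎
    where
    p-1≤2 = ≤-trans (m∸n≤m p 1) p≤2
    p-1≤s = ∸-monoˡ-≤ 1 p≤1+s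

  Ψ₁-branch-nonEdge s (suc t) p _ _ (s≤s ())

  Ψ₁-branch-fresh : ∀ s t → 2 ≤ s → t ≤ 1 → 2 * (Ψ₁ s t 2 + Ψ₁ s t 0) ≤ Ψ₁ (suc s) t 0
  Ψ₁-branch-fresh s t 2≤s t≤1 with suc s <? 29
  ... | yes 1+s<29 = begin
    2 * (Ψ₁ s t 2 + Ψ₁ s t 0)
      ≡⟨ cong₂ (λ x y → 2 * (x + y)) (Ψ₁-table s t 2 s<29) (Ψ₁-table s t 0 s<29) ⟩
    2 * (D s t 2 * W s + D s t 0 * W s)   ≡⟨ 2*[W+W] (D s t 2) (D s t 0) s ⟩
    (D s t 2 + D s t 0) * W (suc s)       ≤⟨ *-monoˡ-≤ (W (suc s)) (D-branch-fresh s t 1+s<29 t≤1 2≤s) ⟩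
    D (suc s) t 0 * W (suc s)             ≡⟨ Ψ₁-table (suc s) t 0 1+s<29 ⟨
    Ψ₁ (suc s) t 0                        ∎
    where s<29 = <-trans (n<1+n s) 1+s<29
  ... | no 1+s≮29 = begin
    2 * (Ψ₁ s t 2 + Ψ₁ s t 0)
      ≤⟨ *-monoʳ-≤ 2 (+-mono-≤ (Ψ₁≤tail s t 2 t≤1 ≤-refl 2≤s) (Ψ₁≤tail s t 0 t≤1 z≤n z≤n)) ⟩
    2 * (Ψtail s t 2 + Ψtail s t 0)       ≤⟨ Tail₁.Ψ-branch-fresh s t 2≤s t≤1 ⟩
    Ψtail (suc s) t 0                     ≡⟨ Ψ₁-tail (suc s) t 0 (≮⇒≥ 1+s≮29) ⟨
    Ψ₁ (suc s) t 0                        ∎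

  Ψ₁-reduce : ∀ s t p → p ≤ suc s → p ≤ 2 → t ≤ 1 → 2 * Ψ₁ s t (p ∸ 1) ≤ Ψ₁ (suc s) t p
  Ψ₁-reduce s t p p≤1+s p≤2 t≤1 with suc s <? 29
  ... | yes 1+s<29 = begin
    2 * Ψ₁ s t (p ∸ 1)            ≡⟨ cong (2 *_) (Ψ₁-table s t (p ∸ 1) (<-trans (n<1+n s) 1+s<29)) ⟩
    2 * (D s t (p ∸ 1) * W s)     ≡⟨ 2*W (D s t (p ∸ 1)) s ⟩
    D s t (p ∸ 1) * W (suc s)     ≤⟨ *-monoˡ-≤ (W (suc s)) (D-reduce s t p 1+s<29 t≤1 p≤2 p≤1+s) ⟩
    D (suc s) t p * W (suc s)     ≡⟨ Ψ₁-table (suc s) t p 1+s<29 ⟨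
    Ψ₁ (suc s) t p                ∎
  ... | no 1+s≮29 = begin
    2 * Ψ₁ s t (p ∸ 1)
      ≤⟨ *-monoʳ-≤ 2 (Ψ₁≤tail s t (p ∸ 1) t≤1 (≤-trans (m∸n≤m p 1) p≤2) (∸-monoˡ-≤ 1 p≤1+s)) ⟩
    2 * Ψtail s t (p ∸ 1)         ≤⟨ Tail₁.Ψ-reduce s t p p≤1+s p≤2 t≤1 ⟩
    Ψtail (suc s) t p             ≡⟨ Ψ₁-tail (suc s) t p (≮⇒≥ 1+s≮29) ⟨
    Ψ₁ (suc s) t p                ∎

  Ψ₁-mono-budget : ∀ s t p → p ≤ s → p ≤ 2 → suc t ≤ 1 → Ψ₁ s t p ≤ Ψ₁ s (suc t) p
  Ψ₁-mono-budget s zero p p≤s p≤2 1+t≤1 with s <? 29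
  ... | yes s<29 = subst₂ _≤_ (sym (Ψ₁-table s 0 p s<29)) (sym (Ψ₁-table s 1 p s<29))
                     (*-monoˡ-≤ (W s) (D-mono-budget s p s<29 p≤2 p≤s))
  ... | no  s≮29 = subst₂ _≤_ (sym (Ψ₁-tail s 0 p (≮⇒≥ s≮29))) (sym (Ψ₁-tail s 1 p (≮⇒≥ s≮29)))
                     (Tail₁.Ψ-mono-budget s 0 p p≤s p≤2 1+t≤1)

  Ψ₁-mono-budget s (suc t) p _ _ (s≤s ())

  Ψ₁-antitone-pending : ∀ s t p → suc p ≤ s → suc p ≤ 2 → t ≤ 1 → Ψ₁ s t (suc p) ≤ Ψ₁ s t p
  Ψ₁-antitone-pending s t p 1+p≤s 1+p≤2 t≤1 with s <? 29
  ... | yes s<29 = subst₂ _≤_ (sym (Ψ₁-table s t (suc p) s<29)) (sym (Ψ₁-table s t p s<29))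
                     (*-monoˡ-≤ (W s) (D-antitone-pending s t p s<29 t≤1 1+p≤2 1+p≤s))
  ... | no  s≮29 = subst₂ _≤_ (sym (Ψ₁-tail s t (suc p) (≮⇒≥ s≮29))) (sym (Ψ₁-tail s t p (≮⇒≥ s≮29)))
                     (Tail₁.Ψ-antitone-pending s t p 1+p≤s 1+p≤2 t≤1)

  potential₁ : Potential 1
  potential₁ = record
    { Ψ = Ψ₁ ; W = W ; w = 2 ; W-suc = W-suc
    ; Ψ-leaf = Ψ₁-leaf ; Ψ-branch-nonEdge = Ψ₁-branch-nonEdge ; Ψ-branch-fresh = Ψ₁-branch-fresh
    ; Ψ-reduce = Ψ₁-reduce ; Ψ-mono-budget = Ψ₁-mono-budget ; Ψ-antitone-pending = Ψ₁-antitone-pending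
    }

  tail-final : ∀ s → 29 ≤ s → 16 * 3 ^ s * 200 ^ s < 2 * 2 ^ s * 323 ^ s
  tail-final s 29≤s = subst (λ s → 16 * 3 ^ s * 200 ^ s < 2 * 2 ^ s * 323 ^ s) (m∸n+n≡m 29≤s) (go (s ∸ 29))
    where
    go : ∀ d → 16 * 3 ^ (d + 29) * 200 ^ (d + 29) < 2 * 2 ^ (d + 29) * 323 ^ (d + 29)
    go zero    = from-yes (16 * 3 ^ 29 * 200 ^ 29 <? 2 * 2 ^ 29 * 323 ^ 29)
    go (suc d) = begin-strict
      16 * (3 * 3 ^ e) * (200 * 200 ^ e)    ≡⟨ regroup₁ (3 ^ e) (200 ^ e) ⟩
      600 * (16 * 3 ^ e * 200 ^ e)          <⟨ *-monoʳ-< 600 (go d) ⟩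
      600 * (2 * 2 ^ e * 323 ^ e)           ≤⟨ *-monoˡ-≤ (2 * 2 ^ e * 323 ^ e) (from-yes (600 ≤? 646)) ⟩
      646 * (2 * 2 ^ e * 323 ^ e)           ≡⟨ regroup₂ (2 ^ e) (323 ^ e) ⟩
      2 * (2 * 2 ^ e) * (323 * 323 ^ e)     ∎
      where
      e = d + 29
      regroup₁ : ∀ x y → 16 * (3 * x) * (200 * y) ≡ 600 * (16 * x * y)
      regroup₁ = solve-∀
      regroup₂ : ∀ x y → 646 * (2 * x * y) ≡ 2 * (2 * x) * (323 * y)
      regroup₂ = solve-∀

  final₁ : ∀ s L → L * W s ≤ Ψ₁ s 1 0 → L * 200 ^ s < 2 * 323 ^ s
  final₁ s L bound with s <? 29
  ... | yes s<29 = ≤-<-trans (*-monoˡ-≤ (200 ^ s) L≤D) (D-final s s<29)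
    where
    L≤D : L ≤ D s 1 0
    L≤D = *-cancelʳ-≤ L (D s 1 0) (W s) {{>-nonZero (subst (0 <_) (sym (*-identityˡ (2 ^ s))) (m^n>0 2 s))}}
            (subst (L * W s ≤_) (Ψ₁-table s 1 0 s<29) bound)
  ... | no  s≮29 = *-cancelˡ-< (2 ^ s) (L * 200 ^ s) (2 * 323 ^ s) (begin-strict
    2 ^ s * (L * 200 ^ s)           ≡⟨ regroup₁ (2 ^ s) L (200 ^ s) ⟩
    (L * (1 * 2 ^ s)) * 200 ^ s     ≤⟨ *-monoˡ-≤ (200 ^ s) (subst (L * W s ≤_) (Ψ₁-tail s 1 0 (≮⇒≥ s≮29)) bound) ⟩
    (16 * (3 ^ s * 1)) * 200 ^ s    ≡⟨ cong (λ x → 16 * x * 200 ^ s) (*-identityʳ (3 ^ s)) ⟩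
    16 * 3 ^ s * 200 ^ s            <⟨ tail-final s (≮⇒≥ s≮29) ⟩
    2 * 2 ^ s * 323 ^ s             ≡⟨ regroup₂ (2 ^ s) (323 ^ s) ⟩
    2 ^ s * (2 * 323 ^ s)           ∎)
    where
    regroup₁ : ∀ x L y → x * (L * y) ≡ (L * (1 * x)) * y
    regroup₁ = solve-∀
    regroup₂ : ∀ x y → 2 * x * y ≡ x * (2 * y)
    regroup₂ = solve-∀

  certificate : Certificate 1
  certificate = record
    { potential = potential₁ ; a = 323 ; b = 200 ; 1≤b = from-yes (1 ≤? 200) ; b≤a = from-yes (200 ≤? 323)
    ; pk<0 = from-yes (323 ^ 3 + 200 ^ 3 <? 2 * 323 ^ 2 * 200) ; final = final₁ }

module _ {k} (C : Certificate k) {n} (G : Graph n) where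
  open Certificate C
  open Potential potential
  open PotentialProperties potential
  open SearchTreeBound potential G

  -- I.g and I.S are already reduced, so I is also the tree of a run started at I's own state.
  root-bound : ∀ {V S I} → Run k G V S I → leaves I * W (size I) ≤ Ψ (size I) k 0
  root-bound (leafR {V' = V′} _ _) rewrite ∣p─p∣≡0 V′ =
    ≤-trans (≤-reflexive (*-identityˡ (W 0))) (Ψ-leaf 0 k 0 z≤n z≤n ≤-refl)
  root-bound (nodeR {S' = S′} b (_ , irr) ¬kdc b∈V b∉S br runₗ runᵣ) =
    ≤-trans (run-bound (nodeR b (ε , irr) ¬kdc b∈V b∉S br runₗ runᵣ) none)
            (Ψ-mono-budget-≤ z≤n z≤n (budget≤k S′) ≤-refl)

  leaves<2β^size : ∀ {V S I} → Run k G V S I → LtTwoBetaPow k (leaves I) (size I)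
  leaves<2β^size {I = I} run = ltTwoBetaPow k (leaves I) (size I) b≤a pk<0
    (final (size I) (leaves I) (root-bound run))
    where open Ratio a b {{>-nonZero 1≤b}}

subtree-run : ∀ {k n} {G : Graph n} {V S T I} → Run k G V S T → I ≼ T → ∃₂ λ V′ S′ → Run k G V′ S′ I
subtree-run run                        here       = _ , _ , run
subtree-run (nodeR _ _ _ _ _ _ runₗ _) (inL I≼l) = subtree-run runₗ I≼l
subtree-run (nodeR _ _ _ _ _ _ _ runᵣ) (inR I≼r) = subtree-run runᵣ I≼r

topLevel-run : ∀ {k n} {G : Graph n} {T} → TopLevelTree k G T → ∃₂ λ V S → Run k G V S T
topLevel-run (inj₁ (_ , _ , _ , run))         = _ , _ , run
topLevel-run (inj₂ (_ , _ , _ , _ , _ , run)) = _ , _ , run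

certificate : ∀ k → 1 ≤ k → Certificate k
certificate 1                   _ = k≡1.certificate
certificate 2                   _ = certificate₂
certificate 3                   _ = certificate₃
certificate (suc (suc (suc (suc j)))) _ = k≥4.certificate j

mainTheorem6 : (k : ℕ) → 1 ≤ k → (n : ℕ) → (G : Graph n) → (T : Tree n) →
               TopLevelTree k G T →
               (I : Tree n) → I ≼ T → LtTwoBetaPow k (leaves I) (size I)
mainTheorem6 k 1≤k n G T top I I≼T
  with _ , _ , run ← topLevel-run top
  with _ , _ , runᴵ ← subtree-run run I≼T
  = leaves<2β^size (certificate k 1≤k) G runᴵ
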